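{- For every integer $r \geq 4$ there exists $n_0 = n_0(r)$ such that the following holds for every odd $n \geq n_0$. Let $G$ be a graph on $n$ vertices with $\delta(G) \geq \frac{n-1}{2} + (r-3)$. If there is a set $A \subseteq V(G)$ with $|A| = \lceil n/2 \rceil = \frac{n+1}{2}$ and $\langle A \rangle_r = A$, then $m(G, r) = r$.
   Context: Graphs are finite and simple; $\delta(G)$ is the minimum degree and $N(v)$ the neighbourhood of $v$. For an integer $r \geq 2$, the $r$-neighbour bootstrap process on $G$ started from $A \subseteq V(G)$ is defined by $A_0 = A$ and $A_t = A_{t-1} \cup \{v \in V(G) : |N(v) \cap A_{t-1}| \geq r\}$ for $t \geq 1$. The closure is $\langle A \rangle_r = \bigcup_{t \geq 0} A_t$. The set $A$ percolates if $\langle A \rangle_r = V(G)$. Define $m(G,r) = \min\{|A| : A \subseteq V(G),\ \langle A \rangle_r = V(G)\}$. -}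

module Defs where

open import Data.Nat using (ℕ; zero; suc; _≤_; _≤ᵇ_)
open import Data.Bool using (Bool; true; false; _∨_)
open import Data.Fin using (Fin)
open import Data.Fin.Subset using (Subset; _∩_; ∣_∣; _∈_; _∉_)
open import Data.Vec using (tabulate; lookup)
open import Data.Product using (Σ; ∃; _×_)
open import Relation.Binary.PropositionalEquality using (_≡_)

record Graph (n : ℕ) : Set where
  field
    adj    : Fin n → Fin n → Bool
    sym    : ∀ u v → adj u v ≡ adj v u
    irrefl : ∀ v → adj v v ≡ false
open Graph public

N : ∀ {n} → Graph n → Fin n → Subset n
N G v = tabulate (adj G v)

degree : ∀ {n} → Graph n → Fin n → ℕ
degree G v = ∣ N G v ∣

MinDegreeAtLeast : ∀ {n} → Graph n → ℕ → Set
MinDegreeAtLeast G d = ∀ v → d ≤ degree G v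

step : ∀ {n} → Graph n → ℕ → Subset n → Subset n
step G r B = tabulate (λ v → lookup B v ∨ (r ≤ᵇ ∣ N G v ∩ B ∣))

iter : ∀ {n} → Graph n → ℕ → Subset n → ℕ → Subset n
iter G r A zero    = A
iter G r A (suc t) = step G r (iter G r A t)

InClosure : ∀ {n} → Graph n → ℕ → Subset n → Fin n → Set
InClosure G r A v = ∃ λ t → v ∈ iter G r A t

Closed : ∀ {n} → Graph n → ℕ → Subset n → Set
Closed G r A = ∀ v → InClosure G r A v → v ∈ A

Percolates : ∀ {n} → Graph n → ℕ → Subset n → Set
Percolates G r A = ∀ v → InClosure G r A v

MEquals : ∀ {n} → Graph n → ℕ → ℕ → Set
MEquals G r m =
  (Σ _ λ A → Percolates G r A × ∣ A ∣ ≡ m) ×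
  (∀ A → Percolates G r A → m ≤ ∣ A ∣)

module Submission where

-- Let B be the complement of the closed set A, so |B| = k, and write r = 4 + q.  Closedness
-- and the degree bound give every vertex of B between 2 + q and 3 + q neighbours in A, hence
-- all but at most two vertices of B as neighbours; so a few vertices of B always have many
-- common neighbours in B.  A set S of r − 2 such common neighbours plus two suitable extra
-- vertices percolates: the extra vertices pull two vertices b₁, b₂ of B into the closure, then
-- their common neighbour b₃, and r + 1 infected vertices of B infect all of B.  Afterwards three
-- infected vertices of A, or two with few neighbours in B (by double counting the edges between
-- A and B), infect everything.  The extra vertices exist as soon as two vertices of A have r
-- neighbours in B, or a vertex of B is a "hub": adjacent to two vertices of A with few
-- neighbours in B, two of the three being adjacent to a further vertex of B.  Otherwise r ≥ 5
-- is impossible, and for r = 4 counting around the vertices of A with at most one neighbour in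
-- B produces such a hub in A instead.  Sets of fewer than r vertices are closed, so
-- m(G, r) = r.

open import Defs hiding (sym)
open import Data.Bool using (Bool; true; false; T; if_then_else_)
open import Data.Bool.Properties using (T-∨)
open import Data.Empty using (⊥-elim) renaming (⊥ to ⊥₀)
open import Data.Fin using (Fin; zero; suc; _≟_)
open import Data.Fin.Properties using (any?)
open import Data.Fin.Subset
open import Data.Fin.Subset.Properties
open import Data.List using ([]; _∷_; length)
open import Data.List.Relation.Unary.All using (All; []; _∷_)
import Data.List.Relation.Unary.All as All
open import Data.List.Relation.Unary.AllPairs using (AllPairs; []; _∷_)
open import Data.Nat using (ℕ; zero; suc; _+_; _*_; _∸_; _≤_; _<_; _≤ᵇ_; z≤n; s≤s)
open import Data.Nat.Properties hiding (_≟_)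
open import Data.Nat.Tactic.RingSolver using (solve-∀)
open import Data.Product using (Σ; ∃; _×_; _,_; proj₁; proj₂)
open import Data.Sum using (_⊎_; inj₁; inj₂; [_,_]′)
open import Data.Vec using (_∷_; []; lookup; tabulate; here; there)
open import Data.Vec.Properties using (lookup∘tabulate)
open import Function using (_∘_; id; Equivalence)
open import Relation.Nullary using (¬_; Dec; yes; no; contradiction)
open import Relation.Nullary.Decidable using (⌊_⌋; toWitness; fromWitness; _×-dec_; _⊎-dec_; ¬?)
open import Relation.Unary using (Pred; Decidable)
open import Relation.Binary.PropositionalEquality
open import Algebra.Properties.CommutativeSemigroup +-commutativeSemigroup
  using (x∙yz≈y∙xz; xy∙z≈xz∙y; interchange)

-- Finite subsets

private variable
  m : ℕ
  p q u : Subset m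
  x y : Fin m
  f g : Fin m → ℕ

∣p∩q∣+∣p∪q∣≡∣p∣+∣q∣ : ∀ (p q : Subset m) → ∣ p ∩ q ∣ + ∣ p ∪ q ∣ ≡ ∣ p ∣ + ∣ q ∣
∣p∩q∣+∣p∪q∣≡∣p∣+∣q∣ []          []          = refl
∣p∩q∣+∣p∪q∣≡∣p∣+∣q∣ (true ∷ p)  (true ∷ q)  = cong suc (begin
  ∣ p ∩ q ∣ + suc ∣ p ∪ q ∣ ≡⟨ +-suc ∣ p ∩ q ∣ ∣ p ∪ q ∣ ⟩
  suc (∣ p ∩ q ∣ + ∣ p ∪ q ∣) ≡⟨ cong suc (∣p∩q∣+∣p∪q∣≡∣p∣+∣q∣ p q) ⟩
  suc (∣ p ∣ + ∣ q ∣) ≡⟨ +-suc ∣ p ∣ ∣ q ∣ ⟨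
  ∣ p ∣ + suc ∣ q ∣ ∎)
  where open ≡-Reasoning
∣p∩q∣+∣p∪q∣≡∣p∣+∣q∣ (true ∷ p)  (false ∷ q) =
  trans (+-suc _ _) (cong suc (∣p∩q∣+∣p∪q∣≡∣p∣+∣q∣ p q))
∣p∩q∣+∣p∪q∣≡∣p∣+∣q∣ (false ∷ p) (true ∷ q)  =
  trans (+-suc _ _) (trans (cong suc (∣p∩q∣+∣p∪q∣≡∣p∣+∣q∣ p q)) (sym (+-suc _ _)))
∣p∩q∣+∣p∪q∣≡∣p∣+∣q∣ (false ∷ p) (false ∷ q) = ∣p∩q∣+∣p∪q∣≡∣p∣+∣q∣ p q

∣p∪q∣≤∣p∣+∣q∣ : ∀ (p q : Subset m) → ∣ p ∪ q ∣ ≤ ∣ p ∣ + ∣ q ∣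
∣p∪q∣≤∣p∣+∣q∣ p q = m+n≤o⇒n≤o ∣ p ∩ q ∣ (≤-reflexive (∣p∩q∣+∣p∪q∣≡∣p∣+∣q∣ p q))

∣p∪⁅x⁆∪⁅y⁆∣≤∣p∣+2 : ∀ (p : Subset m) x y → ∣ p ∪ ⁅ x ⁆ ∪ ⁅ y ⁆ ∣ ≤ ∣ p ∣ + 2
∣p∪⁅x⁆∪⁅y⁆∣≤∣p∣+2 p x y = begin
  ∣ p ∪ ⁅ x ⁆ ∪ ⁅ y ⁆ ∣       ≤⟨ ∣p∪q∣≤∣p∣+∣q∣ p (⁅ x ⁆ ∪ ⁅ y ⁆) ⟩
  ∣ p ∣ + ∣ ⁅ x ⁆ ∪ ⁅ y ⁆ ∣   ≤⟨ +-monoʳ-≤ ∣ p ∣ (∣p∪q∣≤∣p∣+∣q∣ ⁅ x ⁆ ⁅ y ⁆) ⟩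
  ∣ p ∣ + (∣ ⁅ x ⁆ ∣ + ∣ ⁅ y ⁆ ∣) ≡⟨ cong (∣ p ∣ +_) (cong₂ _+_ (∣⁅x⁆∣≡1 x) (∣⁅x⁆∣≡1 y)) ⟩
  ∣ p ∣ + 2                   ∎
  where open ≤-Reasoning

∣p∣≡∣p∩q∣+∣p∩∁q∣ : ∀ (p q : Subset m) → ∣ p ∣ ≡ ∣ p ∩ q ∣ + ∣ p ∩ ∁ q ∣
∣p∣≡∣p∩q∣+∣p∩∁q∣ []          []          = refl
∣p∣≡∣p∩q∣+∣p∩∁q∣ (true ∷ p)  (true ∷ q)  = cong suc (∣p∣≡∣p∩q∣+∣p∩∁q∣ p q)
∣p∣≡∣p∩q∣+∣p∩∁q∣ (true ∷ p)  (false ∷ q) = trans (cong suc (∣p∣≡∣p∩q∣+∣p∩∁q∣ p q)) (sym (+-suc _ _))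
∣p∣≡∣p∩q∣+∣p∩∁q∣ (false ∷ p) (_ ∷ q)     = ∣p∣≡∣p∩q∣+∣p∩∁q∣ p q

p⊆u⇒q⊆u⇒∣p∣+∣q∣≤∣p∩q∣+∣u∣ : p ⊆ u → q ⊆ u → ∣ p ∣ + ∣ q ∣ ≤ ∣ p ∩ q ∣ + ∣ u ∣
p⊆u⇒q⊆u⇒∣p∣+∣q∣≤∣p∩q∣+∣u∣ {p = p} {u = u} {q = q} p⊆u q⊆u = begin
  ∣ p ∣ + ∣ q ∣         ≡⟨ ∣p∩q∣+∣p∪q∣≡∣p∣+∣q∣ p q ⟨
  ∣ p ∩ q ∣ + ∣ p ∪ q ∣ ≤⟨ +-monoʳ-≤ ∣ p ∩ q ∣ (p⊆q⇒∣p∣≤∣q∣ p∪q⊆u) ⟩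
  ∣ p ∩ q ∣ + ∣ u ∣     ∎
  where
  open ≤-Reasoning
  p∪q⊆u : p ∪ q ⊆ u
  p∪q⊆u x∈ = [ p⊆u , q⊆u ]′ (x∈p∪q⁻ p q x∈)

∩-lower-bound : ∀ {a b c} → p ⊆ u → q ⊆ u → c ≤ ∣ p ∣ + a → ∣ u ∣ ≤ ∣ q ∣ + b →
                c ≤ ∣ p ∩ q ∣ + (a + b)
∩-lower-bound {p = p} {u = u} {q = q} {a} {b} {c} p⊆u q⊆u c≤ ∣u∣≤ =
  +-cancelʳ-≤ ∣ u ∣ c (∣ p ∩ q ∣ + (a + b)) (begin
    c + ∣ u ∣                     ≤⟨ +-mono-≤ c≤ ∣u∣≤ ⟩
    (∣ p ∣ + a) + (∣ q ∣ + b)     ≡⟨ interchange (∣ p ∣) a (∣ q ∣) b ⟩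
    (∣ p ∣ + ∣ q ∣) + (a + b)     ≤⟨ +-monoˡ-≤ (a + b) (p⊆u⇒q⊆u⇒∣p∣+∣q∣≤∣p∩q∣+∣u∣ p⊆u q⊆u) ⟩
    (∣ p ∩ q ∣ + ∣ u ∣) + (a + b) ≡⟨ xy∙z≈xz∙y (∣ p ∩ q ∣) (∣ u ∣) (a + b) ⟩
    (∣ p ∩ q ∣ + (a + b)) + ∣ u ∣ ∎)
  where open ≤-Reasoning

x∉p-x : ∀ (p : Subset m) x → x ∉ p - x
x∉p-x (_ ∷ p) zero    ()
x∉p-x (_ ∷ p) (suc x) (there x∈) = x∉p-x p x x∈

x∈p-y⇒x≢y : x ∈ p - y → x ≢ y
x∈p-y⇒x≢y {p = p} x∈ refl = x∉p-x p _ x∈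

∣p∣≤1+∣p-x∣ : ∀ (p : Subset m) x → ∣ p ∣ ≤ suc ∣ p - x ∣
∣p∣≤1+∣p-x∣ (true  ∷ p) zero    = s≤s (≤-reflexive (cong ∣_∣ (sym (p─⊥≡p p))))
∣p∣≤1+∣p-x∣ (false ∷ p) zero    = m≤n⇒m≤1+n (≤-reflexive (cong ∣_∣ (sym (p─⊥≡p p))))
∣p∣≤1+∣p-x∣ (true  ∷ p) (suc x) = s≤s (∣p∣≤1+∣p-x∣ p x)
∣p∣≤1+∣p-x∣ (false ∷ p) (suc x) = ∣p∣≤1+∣p-x∣ p x

remove-lower-bound : ∀ {c e} x → c ≤ ∣ p ∣ + e → c ≤ ∣ p - x ∣ + suc e
remove-lower-bound {p = p} {c = c} {e = e} x c≤ = begin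
  c                   ≤⟨ c≤ ⟩
  ∣ p ∣ + e           ≤⟨ +-monoˡ-≤ e (∣p∣≤1+∣p-x∣ p x) ⟩
  suc ∣ p - x ∣ + e   ≡⟨ +-suc ∣ p - x ∣ e ⟨
  ∣ p - x ∣ + suc e   ∎
  where open ≤-Reasoning

1≤∣p∣⇒Nonempty : 1 ≤ ∣ p ∣ → Nonempty p
1≤∣p∣⇒Nonempty {p = true  ∷ p} _     = zero , here
1≤∣p∣⇒Nonempty {p = false ∷ p} 1≤∣p∣ = let x , x∈p = 1≤∣p∣⇒Nonempty 1≤∣p∣ in suc x , there x∈p

2≤∣p∣⇒∃≢ : 2 ≤ ∣ p ∣ → ∀ x → ∃ λ y → y ∈ p × y ≢ x
2≤∣p∣⇒∃≢ {p = p} 2≤∣p∣ x =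
  let y , y∈p-x = 1≤∣p∣⇒Nonempty (≤-pred (≤-trans 2≤∣p∣ (∣p∣≤1+∣p-x∣ p x)))
  in  y , p─q⊆p p ⁅ x ⁆ y∈p-x , x∈p-y⇒x≢y y∈p-x

2≤∣p∣⇒∃₂≢ : 2 ≤ ∣ p ∣ → ∃ λ x → ∃ λ y → x ∈ p × y ∈ p × x ≢ y
2≤∣p∣⇒∃₂≢ 2≤∣p∣ =
  let x , x∈p = 1≤∣p∣⇒Nonempty (≤-trans (s≤s z≤n) 2≤∣p∣)
      y , y∈p , y≢x = 2≤∣p∣⇒∃≢ 2≤∣p∣ x
  in  x , y , x∈p , y∈p , y≢x ∘ sym

∃⊆-of-size : ∀ m → m ≤ ∣ p ∣ → ∃ λ q → q ⊆ p × ∣ q ∣ ≡ m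
∃⊆-of-size {m} zero    _ = ⊥ , ⊥⊆ , ∣⊥∣≡0 m
∃⊆-of-size {p = true  ∷ p} (suc m) (s≤s m≤∣p∣) =
  let q , q⊆p , ∣q∣≡m = ∃⊆-of-size m m≤∣p∣ in true ∷ q , s⊆s q⊆p , cong suc ∣q∣≡m
∃⊆-of-size {p = false ∷ p} (suc m) m<∣p∣ =
  let q , q⊆p , ∣q∣≡m = ∃⊆-of-size (suc m) m<∣p∣ in false ∷ q , out⊆ q⊆p , ∣q∣≡m

∣p∣+length≤∣q∣ : ∀ {xs} → p ⊆ q → AllPairs _≢_ xs → All (λ x → x ∈ q × x ∉ p) xs →
                 ∣ p ∣ + length xs ≤ ∣ q ∣
∣p∣+length≤∣q∣ {p = p} {q = q} {[]} p⊆q [] [] =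
  subst (_≤ ∣ q ∣) (sym (+-identityʳ ∣ p ∣)) (p⊆q⇒∣p∣≤∣q∣ p⊆q)
∣p∣+length≤∣q∣ {p = p} {q = q} {x ∷ xs} p⊆q (x≢xs ∷ distinct) ((x∈q , x∉p) ∷ rest) = begin
  ∣ p ∣ + suc (length xs) ≡⟨ +-suc ∣ p ∣ (length xs) ⟩
  suc (∣ p ∣ + length xs) ≤⟨ s≤s (∣p∣+length≤∣q∣ p⊆q-x distinct rest-x) ⟩
  suc ∣ q - x ∣           ≤⟨ x∈p⇒∣p-x∣<∣p∣ x∈q ⟩
  ∣ q ∣                   ∎
  where
  open ≤-Reasoning
  p⊆q-x : p ⊆ q - x
  p⊆q-x y∈p = x∈p∧x≢y⇒x∈p-y (p⊆q y∈p) λ { refl → x∉p y∈p }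
  rest-x : All (λ y → y ∈ q - x × y ∉ p) xs
  rest-x = All.zipWith (λ { (x≢y , y∈q , y∉p) → x∈p∧x≢y⇒x∈p-y y∈q (x≢y ∘ sym) , y∉p })
                       (x≢xs , rest)

length≤∣q∣ : ∀ {xs} → AllPairs _≢_ xs → All (_∈ q) xs → length xs ≤ ∣ q ∣
length≤∣q∣ {m} {q = q} {xs} distinct xs⊆q = subst (_≤ ∣ q ∣) (cong (_+ length xs) (∣⊥∣≡0 m))
  (∣p∣+length≤∣q∣ ⊥⊆ distinct (All.map (λ x∈q → x∈q , ∉⊥) xs⊆q))

∣p∣<∣q∣ : p ⊆ q → x ∈ q → x ∉ p → ∣ p ∣ < ∣ q ∣
∣p∣<∣q∣ {p = p} {q = q} p⊆q x∈q x∉p =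
  subst (_≤ ∣ q ∣) (+-comm ∣ p ∣ 1) (∣p∣+length≤∣q∣ p⊆q ([] ∷ []) ((x∈q , x∉p) ∷ []))

p⊆q⇒∣q∣≤∣p∣⇒q⊆p : p ⊆ q → ∣ q ∣ ≤ ∣ p ∣ → q ⊆ p
p⊆q⇒∣q∣≤∣p∣⇒q⊆p {p = p} p⊆q ∣q∣≤∣p∣ {x} x∈q with x ∈? p
... | yes x∈p = x∈p
... | no  x∉p = contradiction ∣q∣≤∣p∣ (<⇒≱ (∣p∣<∣q∣ p⊆q x∈q x∉p))

⊆-chain-stabilises : (X : ℕ → Subset m) → (∀ t → X t ⊆ X (suc t)) → ∃ λ t → X (suc t) ⊆ X t
⊆-chain-stabilises {m} X X⊆X⁺ with stabilised-or-growing (suc m)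
  where
  stabilised-or-growing : ∀ t → (∃ λ s → X (suc s) ⊆ X s) ⊎ t ≤ ∣ X t ∣
  stabilised-or-growing zero = inj₂ z≤n
  stabilised-or-growing (suc t) with stabilised-or-growing t | X t ⊂? X (suc t)
  ... | inj₁ s     | _        = inj₁ s
  ... | inj₂ t≤∣X∣ | yes X⊂X⁺ = inj₂ (≤-trans (s≤s t≤∣X∣) (p⊂q⇒∣p∣<∣q∣ X⊂X⁺))
  ... | inj₂ _     | no  X⊄X⁺ = inj₁ (t , X⁺⊆X)
    where
    X⁺⊆X : X (suc t) ⊆ X t
    X⁺⊆X {x} x∈X⁺ with x ∈? X t
    ... | yes x∈X = x∈X
    ... | no  x∉X = contradiction ((λ {y} → X⊆X⁺ t {y}) , x , x∈X⁺ , x∉X) X⊄X⁺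
... | inj₁ stable  = stable
... | inj₂ n<∣X∣   = contradiction (∣p∣≤n (X (suc m))) (<⇒≱ n<∣X∣)

∈⇒T : x ∈ p → T (lookup p x)
∈⇒T here        = _
∈⇒T (there x∈p) = ∈⇒T x∈p

T⇒∈ : T (lookup p x) → x ∈ p
T⇒∈ {p = true ∷ p} {x = zero}  _ = here
T⇒∈ {p = _    ∷ p} {x = suc x} t = there (T⇒∈ t)

∈-tabulate⁻ : ∀ {f : Fin m → Bool} → x ∈ tabulate f → T (f x)
∈-tabulate⁻ {x = x} {f = f} x∈ = subst T (lookup∘tabulate f x) (∈⇒T x∈)

∈-tabulate⁺ : ∀ {f : Fin m → Bool} → T (f x) → x ∈ tabulate f
∈-tabulate⁺ {x = x} {f = f} t = T⇒∈ (subst T (sym (lookup∘tabulate f x)) t)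

filter : ∀ {ℓ} {P : Pred (Fin m) ℓ} → Decidable P → Subset m
filter P? = tabulate (⌊_⌋ ∘ P?)

module _ {ℓ} {P : Pred (Fin m) ℓ} (P? : Decidable P) where

  ∈-filter⁻ : x ∈ filter P? → P x
  ∈-filter⁻ x∈ = toWitness (∈-tabulate⁻ x∈)

  ∈-filter⁺ : P x → x ∈ filter P?
  ∈-filter⁺ px = ∈-tabulate⁺ (fromWitness px)

-- Sums over subsets

∑ : Subset m → (Fin m → ℕ) → ℕ
∑ []          f = 0
∑ (true  ∷ p) f = f zero + ∑ p (f ∘ suc)
∑ (false ∷ p) f = ∑ p (f ∘ suc)

𝟙 : Subset m → Fin m → ℕ
𝟙 q i = if lookup q i then 1 else 0

∈⇒𝟙≡1 : x ∈ p → 𝟙 p x ≡ 1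
∈⇒𝟙≡1 here        = refl
∈⇒𝟙≡1 (there x∈p) = ∈⇒𝟙≡1 x∈p

∑-cong : ∀ (p : Subset m) → (∀ i → f i ≡ g i) → ∑ p f ≡ ∑ p g
∑-cong []          f≡g = refl
∑-cong (true  ∷ p) f≡g = cong₂ _+_ (f≡g zero) (∑-cong p (f≡g ∘ suc))
∑-cong (false ∷ p) f≡g = ∑-cong p (f≡g ∘ suc)

∑-mono : ∀ (p : Subset m) → (∀ {i} → i ∈ p → f i ≤ g i) → ∑ p f ≤ ∑ p g
∑-mono []          f≤g = z≤n
∑-mono (true  ∷ p) f≤g = +-mono-≤ (f≤g here) (∑-mono p (f≤g ∘ there))
∑-mono (false ∷ p) f≤g = ∑-mono p (f≤g ∘ there)

∑-mono-⊆ : ∀ (f : Fin m → ℕ) → p ⊆ q → ∑ p f ≤ ∑ q f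
∑-mono-⊆ {p = []}        {q = []}        f p⊆q = z≤n
∑-mono-⊆ {p = true ∷ p}  {q = true ∷ q}  f p⊆q = +-monoʳ-≤ (f zero) (∑-mono-⊆ (f ∘ suc) (drop-∷-⊆ p⊆q))
∑-mono-⊆ {p = true ∷ p}  {q = false ∷ q} f p⊆q with () ← p⊆q here
∑-mono-⊆ {p = false ∷ p} {q = true ∷ q}  f p⊆q = m≤n⇒m≤o+n (f zero) (∑-mono-⊆ (f ∘ suc) (drop-∷-⊆ p⊆q))
∑-mono-⊆ {p = false ∷ p} {q = false ∷ q} f p⊆q = ∑-mono-⊆ (f ∘ suc) (drop-∷-⊆ p⊆q)

∑-distrib-+ : ∀ (p : Subset m) → ∑ p (λ i → f i + g i) ≡ ∑ p f + ∑ p g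
∑-distrib-+ []          = refl
∑-distrib-+ {f = f} {g = g} (true ∷ p) = trans (cong (f zero + g zero +_) (∑-distrib-+ p))
  (interchange (f zero) (g zero) _ _)
∑-distrib-+ (false ∷ p) = ∑-distrib-+ p

∑-const : ∀ (p : Subset m) c → ∑ p (λ _ → c) ≡ ∣ p ∣ * c
∑-const []          c = refl
∑-const (true  ∷ p) c = cong (c +_) (∑-const p c)
∑-const (false ∷ p) c = ∑-const p c

∑-𝟙 : ∀ (p q : Subset m) → ∑ p (𝟙 q) ≡ ∣ p ∩ q ∣
∑-𝟙 []          []          = refl
∑-𝟙 (true  ∷ p) (true  ∷ q) = cong suc (∑-𝟙 p q)
∑-𝟙 (true  ∷ p) (false ∷ q) = ∑-𝟙 p q
∑-𝟙 (false ∷ p) (_     ∷ q) = ∑-𝟙 p q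

∑-swap : ∀ {l} (p : Subset l) (q : Subset m) (h : Fin l → Fin m → ℕ) →
         ∑ p (λ u → ∑ q (h u)) ≡ ∑ q (λ v → ∑ p (λ u → h u v))
∑-swap []          q h = sym (trans (∑-const q 0) (*-zeroʳ ∣ q ∣))
∑-swap (true  ∷ p) q h = trans (cong (∑ q (h zero) +_) (∑-swap p q (h ∘ suc)))
                               (sym (∑-distrib-+ q))
∑-swap (false ∷ p) q h = ∑-swap p q (h ∘ suc)

∑-remove : ∀ (f : Fin m → ℕ) → x ∈ p → ∑ p f ≡ f x + ∑ (p - x) f
∑-remove {p = true ∷ p} f here = cong (λ p → f zero + ∑ p (f ∘ suc)) (sym (p─⊥≡p p))
∑-remove {x = suc x} {p = true ∷ p} f (there x∈p) =
  trans (cong (f zero +_) (∑-remove (f ∘ suc) x∈p)) (x∙yz≈y∙xz (f zero) (f (suc x)) (∑ (p - x) (f ∘ suc)))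
∑-remove {p = false ∷ p} f (there x∈p) = ∑-remove (f ∘ suc) x∈p

-- Graphs and bootstrap percolation

module _ {n : ℕ} (G : Graph n) where

  ∈N-sym : y ∈ N G x → x ∈ N G y
  ∈N-sym {y} {x} y∈ = ∈-tabulate⁺ (subst T (Graph.sym G x y) (∈-tabulate⁻ y∈))

  x∉N[x] : x ∉ N G x
  x∉N[x] {x} x∈ = subst T (irrefl G x) (∈-tabulate⁻ x∈)

  ∈N⇒≢ : y ∈ N G x → y ≢ x
  ∈N⇒≢ y∈ refl = x∉N[x] y∈

  ∑∣N∩Q∣≡∑∣N∩P∣ : ∀ (P Q : Subset n) → ∑ P (λ u → ∣ N G u ∩ Q ∣) ≡ ∑ Q (λ v → ∣ N G v ∩ P ∣)
  ∑∣N∩Q∣≡∑∣N∩P∣ P Q = begin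
    ∑ P (λ u → ∣ N G u ∩ Q ∣)             ≡⟨ ∑-cong P (λ u → ∣N∩p∣≡∑𝟙 u Q) ⟩
    ∑ P (λ u → ∑ Q (λ v → 𝟙 (N G u) v))  ≡⟨ ∑-swap P Q (λ u v → 𝟙 (N G u) v) ⟩
    ∑ Q (λ v → ∑ P (λ u → 𝟙 (N G u) v))  ≡⟨ ∑-cong Q (λ v → ∑-cong P (λ u → 𝟙N-sym u v)) ⟩
    ∑ Q (λ v → ∑ P (λ u → 𝟙 (N G v) u))  ≡⟨ ∑-cong Q (λ v → ∣N∩p∣≡∑𝟙 v P) ⟨
    ∑ Q (λ v → ∣ N G v ∩ P ∣)             ∎
    where
    open ≡-Reasoning
    ∣N∩p∣≡∑𝟙 : ∀ u p → ∣ N G u ∩ p ∣ ≡ ∑ p (𝟙 (N G u))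
    ∣N∩p∣≡∑𝟙 u p = trans (cong ∣_∣ (∩-comm (N G u) p)) (sym (∑-𝟙 p (N G u)))
    𝟙N-sym : ∀ u v → 𝟙 (N G u) v ≡ 𝟙 (N G v) u
    𝟙N-sym u v = cong (λ b → if b then 1 else 0) (begin
      lookup (N G u) v ≡⟨ lookup∘tabulate (adj G u) v ⟩
      adj G u v        ≡⟨ Graph.sym G u v ⟩
      adj G v u        ≡⟨ lookup∘tabulate (adj G v) u ⟨
      lookup (N G v) u ∎)

  ∣X-v∣≤∣N∩X∣⇒X-v⊆N : ∀ {X : Subset n} {v} → ∣ X - v ∣ ≤ ∣ N G v ∩ X ∣ → X - v ⊆ N G v
  ∣X-v∣≤∣N∩X∣⇒X-v⊆N {X} {v} ∣X-v∣≤ = p∩q⊆p _ _ ∘ p⊆q⇒∣q∣≤∣p∣⇒q⊆p N∩X⊆X-v ∣X-v∣≤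
    where
    N∩X⊆X-v : N G v ∩ X ⊆ X - v
    N∩X⊆X-v x∈ = x∈p∧x≢y⇒x∈p-y (p∩q⊆q _ _ x∈) (∈N⇒≢ (p∩q⊆p _ _ x∈))

  module Bootstrap (r : ℕ) where

    StepClosed : Subset n → Set
    StepClosed C = ∀ v → r ≤ ∣ N G v ∩ C ∣ → v ∈ C

    private variable
      A C S X : Subset n

    ∈-step⁻ : x ∈ step G r X → x ∈ X ⊎ r ≤ ∣ N G x ∩ X ∣
    ∈-step⁻ {x} {X} x∈ with Equivalence.to T-∨ (∈-tabulate⁻ x∈)
    ... | inj₁ t = inj₁ (T⇒∈ t)
    ... | inj₂ t = inj₂ (≤ᵇ⇒≤ r _ t)

    ∈-step⁺ : x ∈ X ⊎ r ≤ ∣ N G x ∩ X ∣ → x ∈ step G r X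
    ∈-step⁺ (inj₁ x∈X) = ∈-tabulate⁺ (Equivalence.from T-∨ (inj₁ (∈⇒T x∈X)))
    ∈-step⁺ (inj₂ r≤)  = ∈-tabulate⁺ (Equivalence.from T-∨ (inj₂ (≤⇒≤ᵇ r≤)))

    Closed⇒StepClosed : Closed G r A → StepClosed A
    Closed⇒StepClosed closed v r≤ = closed v (1 , ∈-step⁺ (inj₂ r≤))

    A⊆iter : ∀ t → A ⊆ iter G r A t
    A⊆iter zero    x∈A = x∈A
    A⊆iter (suc t) x∈A = ∈-step⁺ (inj₁ (A⊆iter t x∈A))

    iter⊆ : StepClosed C → A ⊆ C → ∀ t → iter G r A t ⊆ C
    iter⊆ closed A⊆C zero    x∈ = A⊆C x∈
    iter⊆ {C} closed A⊆C (suc t) {x} x∈ with ∈-step⁻ x∈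
    ... | inj₁ x∈iter = iter⊆ closed A⊆C t x∈iter
    ... | inj₂ r≤     = closed x (≤-trans r≤ (p⊆q⇒∣p∣≤∣q∣ N∩iter⊆N∩C))
      where
      N∩iter⊆N∩C : N G x ∩ iter G r _ t ⊆ N G x ∩ C
      N∩iter⊆N∩C y∈ with x∈p∩q⁻ (N G x) _ y∈
      ... | y∈N , y∈iter = x∈p∩q⁺ (y∈N , iter⊆ closed A⊆C t y∈iter)

    iter-stabilises : ∀ A → ∃ λ t → StepClosed (iter G r A t)
    iter-stabilises A =
      let t , X⁺⊆X = ⊆-chain-stabilises (iter G r A) (λ t x∈ → ∈-step⁺ (inj₁ x∈))
      in  t , λ v r≤ → X⁺⊆X (∈-step⁺ (inj₂ r≤))

    Spans : Subset n → Set
    Spans A = ∀ C → StepClosed C → A ⊆ C → ∀ v → v ∈ C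

    Spans⇒Percolates : Spans A → Percolates G r A
    Spans⇒Percolates {A} spans v =
      let t , closed = iter-stabilises A in t , spans (iter G r A t) closed (A⊆iter t) v

    ∣A∣<r⇒StepClosed : ∣ A ∣ < r → StepClosed A
    ∣A∣<r⇒StepClosed {A} ∣A∣<r v r≤ = contradiction (≤-trans r≤ (∣p∩q∣≤∣q∣ (N G v) A)) (<⇒≱ ∣A∣<r)

    Percolates⇒r≤∣A∣ : r ≤ n → Percolates G r A → r ≤ ∣ A ∣
    Percolates⇒r≤∣A∣ {A} r≤n percolates with r ≤? ∣ A ∣
    ... | yes r≤∣A∣ = r≤∣A∣
    ... | no  r≰∣A∣ = contradiction (≤-trans r≤n n≤∣A∣) r≰∣A∣
      where
      ⊤⊆A : ⊤ ⊆ A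
      ⊤⊆A {v} _ = let t , v∈ = percolates v in iter⊆ (∣A∣<r⇒StepClosed (≰⇒> r≰∣A∣)) (λ x → x) t v∈
      n≤∣A∣ : n ≤ ∣ A ∣
      n≤∣A∣ = subst (_≤ ∣ A ∣) (∣⊤∣≡n n) (p⊆q⇒∣p∣≤∣q∣ ⊤⊆A)

    two-more-neighbours⇒∈ : ∀ {v x y} → StepClosed C → S ⊆ C → S ⊆ N G v → r ≤ ∣ S ∣ + 2 →
      x ∈ C → x ∈ N G v → x ∉ S → y ∈ C → y ∈ N G v → y ∉ S → x ≢ y → v ∈ C
    two-more-neighbours⇒∈ {C} {S} {v} closed S⊆C S⊆N r≤ x∈C x∈N x∉S y∈C y∈N y∉S x≢y =
      closed v (≤-trans r≤ (∣p∣+length≤∣q∣ S⊆N∩C ((x≢y ∷ []) ∷ [] ∷ [])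
        ((x∈p∩q⁺ (x∈N , x∈C) , x∉S) ∷ (x∈p∩q⁺ (y∈N , y∈C) , y∉S) ∷ [])))
      where
      S⊆N∩C : S ⊆ N G v ∩ C
      S⊆N∩C z∈S = x∈p∩q⁺ (S⊆N z∈S , S⊆C z∈S)

    ∉-StepClosed⇒∣N∩C∣<r : ∀ {v} → StepClosed C → v ∉ C → ∣ N G v ∩ C ∣ < r
    ∉-StepClosed⇒∣N∩C∣<r {C} {v} closed v∉C with r ≤? ∣ N G v ∩ C ∣
    ... | yes r≤ = contradiction (closed v r≤) v∉C
    ... | no  r≰ = ≰⇒> r≰

    Spans⇒∣A∣≤r⇒m≡r : r ≤ n → Spans A → ∣ A ∣ ≤ r → MEquals G r r
    Spans⇒∣A∣≤r⇒m≡r {A} r≤n spans ∣A∣≤r =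
      (A , Spans⇒Percolates spans , ≤-antisym ∣A∣≤r (Percolates⇒r≤∣A∣ r≤n (Spans⇒Percolates spans))) ,
      λ _ → Percolates⇒r≤∣A∣ r≤n

-- For r = 4 + q the degree bound (n − 1)/2 + (r − 3) of the paper reads k + 1 + q.
module Setting {k q : ℕ} (G : Graph (2 * k + 1)) (A : Subset (2 * k + 1))
  (24+q≤k : 24 + q ≤ k)
  (δ≥k+1+q : MinDegreeAtLeast G (k + suc q))
  (∣A∣≡1+k : ∣ A ∣ ≡ suc k)
  (A-stepClosed : Bootstrap.StepClosed G (4 + q) A)
  where

  n : ℕ
  n = 2 * k + 1

  r : ℕ
  r = 4 + q

  open Bootstrap G r public

  B : Subset n
  B = ∁ A

  degA degB : Fin n → ℕ
  degA v = ∣ N G v ∩ A ∣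
  degB v = ∣ N G v ∩ B ∣

  private variable
    a b v : Fin n
    C X Y : Subset n

  ∣B∣≡k : ∣ B ∣ ≡ k
  ∣B∣≡k = begin
    ∣ ∁ A ∣             ≡⟨ ∣∁p∣≡n∸∣p∣ A ⟩
    n ∸ ∣ A ∣           ≡⟨ cong₂ _∸_ (2k+1≡1+k+k k) ∣A∣≡1+k ⟩
    suc k + k ∸ suc k   ≡⟨ m+n∸m≡n (suc k) k ⟩
    k                   ∎
    where
    open ≡-Reasoning
    2k+1≡1+k+k : ∀ k → 2 * k + 1 ≡ suc k + k
    2k+1≡1+k+k = solve-∀

  degree≡degA+degB : ∀ v → degree G v ≡ degA v + degB v
  degree≡degA+degB v = ∣p∣≡∣p∩q∣+∣p∩∁q∣ (N G v) A

  degA≤3+q : b ∈ B → degA b ≤ 3 + q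
  degA≤3+q b∈B = ≤-pred (∉-StepClosed⇒∣N∩C∣<r A-stepClosed (x∈∁p⇒x∉p b∈B))

  degB<k : b ∈ B → degB b < k
  degB<k {b} b∈B = subst (degB b <_) ∣B∣≡k
    (∣p∣<∣q∣ (p∩q⊆q (N G b) B) b∈B (x∉N[x] G ∘ proj₁ ∘ x∈p∩q⁻ (N G b) B))

  degA≤k : a ∈ A → degA a ≤ k
  degA≤k {a} a∈A = ≤-pred (subst (degA a <_) ∣A∣≡1+k
    (∣p∣<∣q∣ (p∩q⊆q (N G a) A) a∈A (x∉N[x] G ∘ proj₁ ∘ x∈p∩q⁻ (N G a) A)))

  c+d≤k⇒c+1+q≤e : ∀ {v} c {d e} → degree G v ≡ d + e → c + d ≤ k → c + suc q ≤ e
  c+d≤k⇒c+1+q≤e {v} c {d} {e} deg≡ c+d≤k = +-cancelʳ-≤ d (c + suc q) e (begin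
    c + suc q + d ≡⟨ xy∙z≈xz∙y c (suc q) d ⟩
    c + d + suc q ≤⟨ +-monoˡ-≤ (suc q) c+d≤k ⟩
    k + suc q     ≤⟨ δ≥k+1+q v ⟩
    degree G v    ≡⟨ deg≡ ⟩
    d + e         ≡⟨ +-comm d e ⟩
    e + d         ∎)
    where open ≤-Reasoning

  d≤3+q⇒k≤e+2 : ∀ {v d e} → degree G v ≡ d + e → d ≤ 3 + q → k ≤ e + 2
  d≤3+q⇒k≤e+2 {v} {d} {e} deg≡ d≤3+q = +-cancelʳ-≤ (suc q) k (e + 2) (begin
    k + suc q     ≤⟨ δ≥k+1+q v ⟩
    degree G v    ≡⟨ deg≡ ⟩
    d + e         ≤⟨ +-monoˡ-≤ e d≤3+q ⟩
    3 + q + e     ≡⟨ +-comm (3 + q) e ⟩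
    e + (3 + q)   ≡⟨ +-assoc e 2 (suc q) ⟨
    e + 2 + suc q ∎)
    where open ≤-Reasoning

  k≤degB+2 : b ∈ B → k ≤ degB b + 2
  k≤degB+2 {b} b∈B = d≤3+q⇒k≤e+2 (degree≡degA+degB b) (degA≤3+q b∈B)

  degB≤3+q⇒k≤degA+2 : degB a ≤ 3 + q → k ≤ degA a + 2
  degB≤3+q⇒k≤degA+2 {a} = d≤3+q⇒k≤e+2 (trans (degree≡degA+degB a) (+-comm (degA a) (degB a)))

  2+q≤degA : b ∈ B → 2 + q ≤ degA b
  2+q≤degA {b} b∈B =
    c+d≤k⇒c+1+q≤e 1 (trans (degree≡degA+degB b) (+-comm (degA b) (degB b))) (degB<k b∈B)

  1+q≤degB : a ∈ A → suc q ≤ degB a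
  1+q≤degB {a} a∈A = c+d≤k⇒c+1+q≤e 0 (degree≡degA+degB a) (degA≤k a∈A)

  ∣Y∣≡2+q⇒∣Y∣+2≡r : ∣ Y ∣ ≡ 2 + q → ∣ Y ∣ + 2 ≡ r
  ∣Y∣≡2+q⇒∣Y∣+2≡r ∣S∣≡ = trans (cong (_+ 2) ∣S∣≡) (+-comm (2 + q) 2)

  k+3≤∣C∣⇒⊤⊆C : StepClosed C → k + 3 ≤ ∣ C ∣ → ∀ v → v ∈ C
  k+3≤∣C∣⇒⊤⊆C {C} closed k+3≤∣C∣ v with v ∈? C
  ... | yes v∈C = v∈C
  ... | no  v∉C = closed v (+-cancelʳ-≤ (2 * k) r ∣ N G v ∩ C ∣ (begin
    r + 2 * k                   ≡⟨ r+2k≡ k q ⟩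
    (k + suc q) + (k + 3)       ≤⟨ +-mono-≤ (δ≥k+1+q v) k+3≤∣C∣ ⟩
    ∣ N G v ∣ + ∣ C ∣           ≤⟨ p⊆u⇒q⊆u⇒∣p∣+∣q∣≤∣p∩q∣+∣u∣ N⊆⊤-v C⊆⊤-v ⟩
    ∣ N G v ∩ C ∣ + ∣ ⊤ - v ∣   ≤⟨ +-monoʳ-≤ ∣ N G v ∩ C ∣ ∣⊤-v∣≤2k ⟩
    ∣ N G v ∩ C ∣ + 2 * k       ∎))
    where
    open ≤-Reasoning
    r+2k≡ : ∀ k q → 4 + q + 2 * k ≡ (k + suc q) + (k + 3)
    r+2k≡ = solve-∀
    N⊆⊤-v : N G v ⊆ ⊤ - v
    N⊆⊤-v x∈N = x∈p∧x≢y⇒x∈p-y ∈⊤ (∈N⇒≢ G x∈N)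
    C⊆⊤-v : C ⊆ ⊤ - v
    C⊆⊤-v x∈C = x∈p∧x≢y⇒x∈p-y ∈⊤ λ { refl → v∉C x∈C }
    ∣⊤-v∣≤2k : ∣ ⊤ - v ∣ ≤ 2 * k
    ∣⊤-v∣≤2k = ≤-pred (subst (∣ ⊤ - v ∣ <_) (trans (∣⊤∣≡n n) (+-comm (2 * k) 1)) (x∈p⇒∣p-x∣<∣p∣ {n} {v} {⊤} ∈⊤))

  B⊆C⇒3≤∣C∩A∣⇒⊤⊆C : StepClosed C → B ⊆ C → 3 ≤ ∣ C ∩ A ∣ → ∀ v → v ∈ C
  B⊆C⇒3≤∣C∩A∣⇒⊤⊆C {C} closed B⊆C 3≤∣C∩A∣ = k+3≤∣C∣⇒⊤⊆C closed (begin
    k + 3                   ≡⟨ +-comm k 3 ⟩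
    3 + k                   ≤⟨ +-mono-≤ 3≤∣C∩A∣ k≤∣C∩B∣ ⟩
    ∣ C ∩ A ∣ + ∣ C ∩ B ∣   ≡⟨ ∣p∣≡∣p∩q∣+∣p∩∁q∣ C A ⟨
    ∣ C ∣                   ∎)
    where
    open ≤-Reasoning
    k≤∣C∩B∣ : k ≤ ∣ C ∩ B ∣
    k≤∣C∩B∣ = subst (_≤ ∣ C ∩ B ∣) ∣B∣≡k (p⊆q⇒∣p∣≤∣q∣ λ x∈B → x∈p∩q⁺ (B⊆C x∈B , x∈B))

  B⊆C⇒r≤degB⇒∈C : StepClosed C → B ⊆ C → r ≤ degB a → a ∈ C
  B⊆C⇒r≤degB⇒∈C {C} {a} closed B⊆C r≤degB = closed a (≤-trans r≤degB (p⊆q⇒∣p∣≤∣q∣ N∩B⊆N∩C))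
    where
    N∩B⊆N∩C : N G a ∩ B ⊆ N G a ∩ C
    N∩B⊆N∩C x∈ = let x∈N , x∈B = x∈p∩q⁻ (N G a) B x∈ in x∈p∩q⁺ (x∈N , B⊆C x∈B)

  1+r≤∣C∩B∣⇒B⊆C : StepClosed C → suc r ≤ ∣ C ∩ B ∣ → B ⊆ C
  1+r≤∣C∩B∣⇒B⊆C {C} closed 1+r≤∣C∩B∣ {b} b∈B with b ∈? C
  ... | yes b∈C = b∈C
  ... | no  b∉C = closed b (≤-trans r≤ (p⊆q⇒∣p∣≤∣q∣ ⊆N∩C))
    where
    bound : suc r ≤ ∣ (C ∩ B) ∩ (N G b ∩ B) ∣ + (0 + 1)
    bound = ∩-lower-bound {u = B - b} C∩B⊆B-b N∩B⊆B-b
      (subst (suc r ≤_) (sym (+-identityʳ _)) 1+r≤∣C∩B∣)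
      (≤-pred (begin
        suc ∣ B - b ∣   ≤⟨ subst (suc ∣ B - b ∣ ≤_) ∣B∣≡k (x∈p⇒∣p-x∣<∣p∣ b∈B) ⟩
        k               ≤⟨ k≤degB+2 b∈B ⟩
        degB b + 2      ≡⟨ +-suc (degB b) 1 ⟩
        suc (degB b + 1) ∎))
      where
      open ≤-Reasoning
      C∩B⊆B-b : C ∩ B ⊆ B - b
      C∩B⊆B-b x∈ = let x∈C , x∈B = x∈p∩q⁻ C B x∈ in x∈p∧x≢y⇒x∈p-y x∈B λ { refl → b∉C x∈C }
      N∩B⊆B-b : N G b ∩ B ⊆ B - b
      N∩B⊆B-b x∈ = let x∈N , x∈B = x∈p∩q⁻ (N G b) B x∈ in x∈p∧x≢y⇒x∈p-y x∈B (∈N⇒≢ G x∈N)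
    r≤ : r ≤ ∣ (C ∩ B) ∩ (N G b ∩ B) ∣
    r≤ = ≤-pred (subst (suc r ≤_) (+-comm _ 1) bound)
    ⊆N∩C : (C ∩ B) ∩ (N G b ∩ B) ⊆ N G b ∩ C
    ⊆N∩C x∈ = let x∈C∩B , x∈N∩B = x∈p∩q⁻ (C ∩ B) _ x∈
              in  x∈p∩q⁺ (proj₁ (x∈p∩q⁻ (N G b) B x∈N∩B) , proj₁ (x∈p∩q⁻ C B x∈C∩B))

  -- For a numeral m ≤ 24 the hypothesis T (m ≤ᵇ 24) is discharged by evaluation, as `_`.
  m+q≤k : ∀ m → T (m ≤ᵇ 24) → m + q ≤ k
  m+q≤k m m≤24 = ≤-trans (+-monoˡ-≤ q (≤ᵇ⇒≤ m 24 m≤24)) 24+q≤k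

  m≤k : ∀ m → T (m ≤ᵇ 24) → m ≤ k
  m≤k m m≤24 = m+n≤o⇒m≤o m (m+q≤k m m≤24)

  NB : Fin n → Subset n
  NB v = N G v ∩ B

  ∩NB-lower-bound : ∀ {c e} → X ⊆ B → c ≤ ∣ X ∣ + e → b ∈ B → c ≤ ∣ X ∩ NB b ∣ + (e + 2)
  ∩NB-lower-bound {b = b} X⊆B c≤ b∈B = ∩-lower-bound X⊆B (p∩q⊆q (N G b) B) c≤
    (subst (_≤ degB b + 2) (sym ∣B∣≡k) (k≤degB+2 b∈B))

  bound⇒Nonempty : ∀ {c e} → c ≤ ∣ X ∣ + e → e < c → Nonempty X
  bound⇒Nonempty {X} {c} {e} c≤ e<c =
    1≤∣p∣⇒Nonempty (+-cancelʳ-≤ e 1 ∣ X ∣ (≤-trans e<c c≤))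

  bound⇒core : ∀ {c e} → c ≤ ∣ X ∣ + e → 2 + q + e ≤ c → ∃ λ S → S ⊆ X × ∣ S ∣ ≡ 2 + q
  bound⇒core {X} {c} {e} c≤ 2+q+e≤c = ∃⊆-of-size (2 + q) (+-cancelʳ-≤ e (2 + q) ∣ X ∣ (≤-trans 2+q+e≤c c≤))

  Seed : Set
  Seed = ∃ λ R → ∣ R ∣ ≤ r × Spans R

  core+2⇒Seed : ∀ {S} x y → ∣ S ∣ ≡ 2 + q →
    (∀ {C} → StepClosed C → S ⊆ C → x ∈ C → y ∈ C → ∀ v → v ∈ C) → Seed
  core+2⇒Seed {S} x y ∣S∣≡ spans =
    S ∪ ⁅ x ⁆ ∪ ⁅ y ⁆ ,
    ≤-trans (∣p∪⁅x⁆∪⁅y⁆∣≤∣p∣+2 S x y) (≤-reflexive (∣Y∣≡2+q⇒∣Y∣+2≡r {Y = S} ∣S∣≡)) ,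
    λ C closed R⊆C → spans closed (R⊆C ∘ x∈p∪q⁺ ∘ inj₁)
      (R⊆C (x∈p∪q⁺ (inj₂ (x∈p∪q⁺ (inj₁ (x∈⁅x⁆ x))))))
      (R⊆C (x∈p∪q⁺ (inj₂ (x∈p∪q⁺ (inj₂ (x∈⁅x⁆ y))))))

  Low : Fin n → Set
  Low a = a ∈ A × degB a ≤ 3 + q

  Hub : Fin n → Fin n → Fin n → Set
  Hub h a₀ a₁ = a₀ ∈ N G h × a₁ ∈ N G h × Low a₀ × Low a₁ × a₀ ≢ a₁

  TwoOf : Fin n → Fin n → Fin n → Fin n → Set
  TwoOf h a₀ a₁ x = (x ∈ N G a₀ × x ∈ N G a₁) ⊎ (x ∈ N G h × (x ∈ N G a₀ ⊎ x ∈ N G a₁))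

  A∩B≡∅ : a ∈ A → a ∉ B
  A∩B≡∅ = x∈p⇒x∉∁p

  A≢B : a ∈ A → b ∈ B → a ≢ b
  A≢B a∈A b∈B refl = A∩B≡∅ a∈A b∈B

  module Spread {C S : Subset n} (closed : StepClosed C) (S⊆C : S ⊆ C) (S⊆B : S ⊆ B)
                (∣S∣≡2+q : ∣ S ∣ ≡ 2 + q) where

    private variable
      h a₀ a₁ b₁ b₂ b₃ : Fin n

    ∣S∣+2≡r : ∣ S ∣ + 2 ≡ r
    ∣S∣+2≡r = ∣Y∣≡2+q⇒∣Y∣+2≡r {Y = S} ∣S∣≡2+q

    ∉S : S ⊆ N G v → v ∉ S
    ∉S S⊆N v∈S = x∉N[x] G (S⊆N v∈S)

    A∉S : a ∈ A → a ∉ S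
    A∉S a∈A a∈S = A∩B≡∅ a∈A (S⊆B a∈S)

    enter : ∀ {x y} → S ⊆ N G v → x ∈ C → x ∈ N G v → x ∉ S →
            y ∈ C → y ∈ N G v → y ∉ S → x ≢ y → v ∈ C
    enter S⊆N = two-more-neighbours⇒∈ closed S⊆C S⊆N (≤-reflexive (sym ∣S∣+2≡r))

    hub∈C : S ⊆ N G h → Hub h a₀ a₁ → a₀ ∈ C → a₁ ∈ C → h ∈ C
    hub∈C S⊆N (a₀∈N , a₁∈N , (a₀∈A , _) , (a₁∈A , _) , a₀≢a₁) a₀∈C a₁∈C =
      enter S⊆N a₀∈C a₀∈N (A∉S a₀∈A) a₁∈C a₁∈N (A∉S a₁∈A) a₀≢a₁

    TwoOf⇒∈C : S ⊆ N G h → S ⊆ N G x → Hub h a₀ a₁ → h ∈ C → a₀ ∈ C → a₁ ∈ C →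
               TwoOf h a₀ a₁ x → x ∈ C
    TwoOf⇒∈C S⊆Nh S⊆Nx (a₀∈Nh , a₁∈Nh , (a₀∈A , _) , (a₁∈A , _) , a₀≢a₁) h∈C a₀∈C a₁∈C = λ where
      (inj₁ (x∈Na₀ , x∈Na₁)) →
        enter S⊆Nx a₀∈C (∈N-sym G x∈Na₀) (A∉S a₀∈A) a₁∈C (∈N-sym G x∈Na₁) (A∉S a₁∈A) a₀≢a₁
      (inj₂ (x∈Nh , inj₁ x∈Na₀)) →
        enter S⊆Nx h∈C (∈N-sym G x∈Nh) (∉S S⊆Nh) a₀∈C (∈N-sym G x∈Na₀) (A∉S a₀∈A)
              (≢-sym (∈N⇒≢ G a₀∈Nh))
      (inj₂ (x∈Nh , inj₂ x∈Na₁)) →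
        enter S⊆Nx h∈C (∈N-sym G x∈Nh) (∉S S⊆Nh) a₁∈C (∈N-sym G x∈Na₁) (A∉S a₁∈A)
              (≢-sym (∈N⇒≢ G a₁∈Nh))

    cherry⇒B⊆C : b₁ ∈ B → b₂ ∈ B → b₃ ∈ B → S ⊆ N G b₁ → S ⊆ N G b₂ → S ⊆ N G b₃ →
                 b₁ ∈ N G b₃ → b₂ ∈ N G b₃ → b₁ ≢ b₂ → b₁ ∈ C → b₂ ∈ C → B ⊆ C
    cherry⇒B⊆C {b₁} {b₂} {b₃} b₁∈B b₂∈B b₃∈B S⊆N₁ S⊆N₂ S⊆N₃ b₁∈N₃ b₂∈N₃ b₁≢b₂ b₁∈C b₂∈C =
      1+r≤∣C∩B∣⇒B⊆C closed (begin
        suc r           ≡⟨ cong suc ∣S∣+2≡r ⟨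
        suc (∣ S ∣ + 2) ≡⟨ +-suc ∣ S ∣ 2 ⟨
        ∣ S ∣ + 3       ≤⟨ ∣p∣+length≤∣q∣ S⊆C∩B
                             ((b₁≢b₂ ∷ ∈N⇒≢ G b₁∈N₃ ∷ []) ∷ (∈N⇒≢ G b₂∈N₃ ∷ []) ∷ [] ∷ [])
                             ( (x∈p∩q⁺ (b₁∈C , b₁∈B) , ∉S S⊆N₁)
                             ∷ (x∈p∩q⁺ (b₂∈C , b₂∈B) , ∉S S⊆N₂)
                             ∷ (x∈p∩q⁺ (b₃∈C , b₃∈B) , ∉S S⊆N₃) ∷ []) ⟩
        ∣ C ∩ B ∣       ∎)
      where
      open ≤-Reasoning
      S⊆C∩B : S ⊆ C ∩ B
      S⊆C∩B x∈S = x∈p∩q⁺ (S⊆C x∈S , S⊆B x∈S)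
      b₃∈C : b₃ ∈ C
      b₃∈C = enter S⊆N₃ b₁∈C b₁∈N₃ (∉S S⊆N₁) b₂∈C b₂∈N₃ (∉S S⊆N₂) b₁≢b₂

  record Cherry (X : Subset n) (b₁ b₂ : Fin n) : Set where
    field
      b₃      : Fin n
      b₃∈B    : b₃ ∈ B
      b₁∈N₃   : b₁ ∈ N G b₃
      b₂∈N₃   : b₂ ∈ N G b₃
      S       : Subset n
      S⊆X     : S ⊆ X
      S⊆B     : S ⊆ B
      S⊆N₁    : S ⊆ N G b₁
      S⊆N₂    : S ⊆ N G b₂
      S⊆N₃    : S ⊆ N G b₃
      ∣S∣≡2+q : ∣ S ∣ ≡ 2 + q

  cherry : ∀ {c e b₁ b₂} → X ⊆ B → c ≤ ∣ X ∣ + e → 2 + q + (e + 2 + 2 + 2) ≤ c →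
           b₁ ∈ B → b₂ ∈ B → Cherry X b₁ b₂
  cherry {X} {c} {e} {b₁} {b₂} X⊆B c≤∣X∣+e 2+q+e+6≤c b₁∈B b₂∈B =
    let b₃ , b₃∈X₂    = bound⇒Nonempty c≤∣X₂∣+e+4 e+4<c
        S , S⊆X₃ , ∣S∣≡ = bound⇒core (∩NB-lower-bound X₂⊆B c≤∣X₂∣+e+4 (X₂⊆B b₃∈X₂)) 2+q+e+6≤c
    in  record
      { b₃ = b₃ ; b₃∈B = X₂⊆B b₃∈X₂
      ; b₁∈N₃ = ∈N-sym G (X₂⊆N₁ b₃∈X₂) ; b₂∈N₃ = ∈N-sym G (X₂⊆N₂ b₃∈X₂)
      ; S = S ; S⊆X = X₂⊆X ∘ X₃⊆X₂ ∘ S⊆X₃ ; S⊆B = X₂⊆B ∘ X₃⊆X₂ ∘ S⊆X₃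
      ; S⊆N₁ = X₂⊆N₁ ∘ X₃⊆X₂ ∘ S⊆X₃ ; S⊆N₂ = X₂⊆N₂ ∘ X₃⊆X₂ ∘ S⊆X₃
      ; S⊆N₃ = NB⊆N ∘ p∩q⊆q _ _ ∘ S⊆X₃ ; ∣S∣≡2+q = ∣S∣≡ }
    where
    NB⊆N : ∀ {v} → NB v ⊆ N G v
    NB⊆N = p∩q⊆p _ _
    X₂ : Subset n
    X₂ = (X ∩ NB b₁) ∩ NB b₂
    X₂⊆X : X₂ ⊆ X
    X₂⊆X = p∩q⊆p _ _ ∘ p∩q⊆p _ _
    X₂⊆B : X₂ ⊆ B
    X₂⊆B = X⊆B ∘ X₂⊆X
    X₂⊆N₁ : X₂ ⊆ N G b₁
    X₂⊆N₁ = NB⊆N ∘ p∩q⊆q _ _ ∘ p∩q⊆p _ _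
    X₂⊆N₂ : X₂ ⊆ N G b₂
    X₂⊆N₂ = NB⊆N ∘ p∩q⊆q _ _
    X₃⊆X₂ : ∀ {v} → X₂ ∩ NB v ⊆ X₂
    X₃⊆X₂ = p∩q⊆p _ _
    c≤∣X₂∣+e+4 : c ≤ ∣ X₂ ∣ + (e + 2 + 2)
    c≤∣X₂∣+e+4 = ∩NB-lower-bound {X = X ∩ NB b₁} (X⊆B ∘ p∩q⊆p _ _) (∩NB-lower-bound X⊆B c≤∣X∣+e b₁∈B) b₂∈B
    e+4<c : e + 2 + 2 < c
    e+4<c = ≤-trans (m<m+n (e + 2 + 2) (s≤s z≤n)) (≤-trans (m≤n+m _ (2 + q)) 2+q+e+6≤c)

  low-pair-arith : ∀ m → suc m ≤ k → ¬ (k + (k + k * (2 + q)) ≤ 4 + q + (4 + q + m * (3 + q)) + 4)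
  low-pair-arith m 1+m≤k bound =
    contradiction (+-cancelʳ-≤ (q + q) 27 12 (+-cancelʳ-≤ (k * (3 + q)) _ _ chain))
      (<⇒≱ (≤ᵇ⇒≤ 13 27 _))
    where
    open ≤-Reasoning
    e₁ : ∀ k q → 27 + (q + q) + k * (3 + q) ≡ k * (3 + q) + (24 + q) + (3 + q)
    e₁ = solve-∀
    e₂ : ∀ k q → k * (3 + q) + k + (3 + q) ≡ k + (k + k * (2 + q)) + (3 + q)
    e₂ = solve-∀
    e₃ : ∀ m q → 4 + q + (4 + q + m * (3 + q)) + 4 + (3 + q) ≡ 12 + (q + q) + suc m * (3 + q)
    e₃ = solve-∀
    chain : 27 + (q + q) + k * (3 + q) ≤ 12 + (q + q) + k * (3 + q)
    chain = begin
      27 + (q + q) + k * (3 + q)                  ≡⟨ e₁ k q ⟩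
      k * (3 + q) + (24 + q) + (3 + q)            ≤⟨ +-monoˡ-≤ (3 + q) (+-monoʳ-≤ (k * (3 + q)) 24+q≤k) ⟩
      k * (3 + q) + k + (3 + q)                   ≡⟨ e₂ k q ⟩
      k + (k + k * (2 + q)) + (3 + q)             ≤⟨ +-monoˡ-≤ (3 + q) bound ⟩
      4 + q + (4 + q + m * (3 + q)) + 4 + (3 + q) ≡⟨ e₃ m q ⟩
      12 + (q + q) + suc m * (3 + q)              ≤⟨ +-monoʳ-≤ (12 + (q + q)) (*-monoˡ-≤ (3 + q) 1+m≤k) ⟩
      12 + (q + q) + k * (3 + q)                  ∎

  -- If no third vertex of A is infected, every other vertex of A has at most 3 + q neighbours
  -- in B⁺ = B ∪ {a₀, a₁}, whereas B⁺ receives at least k(2 + q) + 2(k − 2) edges from A.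
  module LowPair {a₀ a₁ : Fin n} (a₀≢a₁ : a₀ ≢ a₁) (low₀ : Low a₀) (low₁ : Low a₁) where

    Pair B⁺ : Subset n
    Pair = ⁅ a₀ ⁆ ∪ ⁅ a₁ ⁆
    B⁺   = B ∪ Pair

    a₀∈A : a₀ ∈ A
    a₀∈A = proj₁ low₀

    a₁∈A : a₁ ∈ A
    a₁∈A = proj₁ low₁

    a₀∈Pair : a₀ ∈ Pair
    a₀∈Pair = x∈p∪q⁺ (inj₁ (x∈⁅x⁆ a₀))

    a₁∈Pair-a₀ : a₁ ∈ Pair - a₀
    a₁∈Pair-a₀ = x∈p∧x≢y⇒x∈p-y (x∈p∪q⁺ (inj₂ (x∈⁅x⁆ a₁))) (≢-sym a₀≢a₁)

    ∑B⁺degA-lower : k + (k + k * (2 + q)) ≤ ∑ B⁺ degA + 4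
    ∑B⁺degA-lower = begin
      k + (k + k * (2 + q))                               ≤⟨ +-mono-≤ (degB≤3+q⇒k≤degA+2 (proj₂ low₀))
                                                               (+-mono-≤ (degB≤3+q⇒k≤degA+2 (proj₂ low₁)) ∑B-lower) ⟩
      degA a₀ + 2 + (degA a₁ + 2 + ∑ B degA)              ≤⟨ +-monoʳ-≤ (degA a₀ + 2) (+-monoʳ-≤ (degA a₁ + 2)
                                                               (∑-mono-⊆ degA B⊆B⁺-a₀-a₁)) ⟩
      degA a₀ + 2 + (degA a₁ + 2 + ∑ (B⁺ - a₀ - a₁) degA) ≡⟨ shift-4 (degA a₀) (degA a₁) _ ⟩
      degA a₀ + (degA a₁ + ∑ (B⁺ - a₀ - a₁) degA) + 4     ≡⟨ cong (_+ 4) (trans (∑-remove degA a₀∈B⁺)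
                                                               (cong (degA a₀ +_) (∑-remove degA a₁∈B⁺-a₀))) ⟨
      ∑ B⁺ degA + 4                                       ∎
      where
      open ≤-Reasoning
      shift-4 : ∀ x y z → x + 2 + (y + 2 + z) ≡ x + (y + z) + 4
      shift-4 = solve-∀
      a₀∈B⁺ : a₀ ∈ B⁺
      a₀∈B⁺ = x∈p∪q⁺ (inj₂ a₀∈Pair)
      a₁∈B⁺-a₀ : a₁ ∈ B⁺ - a₀
      a₁∈B⁺-a₀ = x∈p∧x≢y⇒x∈p-y (x∈p∪q⁺ (inj₂ (p─q⊆p _ _ a₁∈Pair-a₀))) (≢-sym a₀≢a₁)
      B⊆B⁺-a₀-a₁ : B ⊆ B⁺ - a₀ - a₁
      B⊆B⁺-a₀-a₁ b∈B = x∈p∧x≢y⇒x∈p-y (x∈p∧x≢y⇒x∈p-y (x∈p∪q⁺ (inj₁ b∈B))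
                          (≢-sym (A≢B a₀∈A b∈B))) (≢-sym (A≢B a₁∈A b∈B))
      ∑B-lower : k * (2 + q) ≤ ∑ B degA
      ∑B-lower = begin
        k * (2 + q)          ≡⟨ cong (_* (2 + q)) ∣B∣≡k ⟨
        ∣ B ∣ * (2 + q)      ≡⟨ ∑-const B (2 + q) ⟨
        ∑ B (λ _ → 2 + q)    ≤⟨ ∑-mono B 2+q≤degA ⟩
        ∑ B degA             ∎

    ∣N∩B⁺∣≤4+q : a ∈ Pair → degB a ≤ 3 + q → ∣ N G a ∩ B⁺ ∣ ≤ 4 + q
    ∣N∩B⁺∣≤4+q {a} a∈Pair degB≤3+q = begin
      ∣ N G a ∩ B⁺ ∣          ≤⟨ p⊆q⇒∣p∣≤∣q∣ N∩B⁺⊆ ⟩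
      ∣ NB a ∪ (Pair - a) ∣   ≤⟨ ∣p∪q∣≤∣p∣+∣q∣ (NB a) (Pair - a) ⟩
      degB a + ∣ Pair - a ∣   ≤⟨ +-mono-≤ degB≤3+q (≤-pred (≤-trans (x∈p⇒∣p-x∣<∣p∣ a∈Pair) ∣Pair∣≤2)) ⟩
      3 + q + 1               ≡⟨ +-comm (3 + q) 1 ⟩
      4 + q                   ∎
      where
      open ≤-Reasoning
      ∣Pair∣≤2 : ∣ Pair ∣ ≤ 2
      ∣Pair∣≤2 = ≤-trans (∣p∪q∣≤∣p∣+∣q∣ ⁅ a₀ ⁆ ⁅ a₁ ⁆) (≤-reflexive (cong₂ _+_ (∣⁅x⁆∣≡1 a₀) (∣⁅x⁆∣≡1 a₁)))
      N∩B⁺⊆ : N G a ∩ B⁺ ⊆ NB a ∪ (Pair - a)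
      N∩B⁺⊆ x∈ with x∈p∩q⁻ (N G a) B⁺ x∈
      ... | x∈N , x∈B⁺ = x∈p∪q⁺ ([ (λ x∈B → inj₁ (x∈p∩q⁺ (x∈N , x∈B)))
                                 , (λ x∈Pair → inj₂ (x∈p∧x≢y⇒x∈p-y x∈Pair (∈N⇒≢ G x∈N)))
                                 ]′ (x∈p∪q⁻ B Pair x∈B⁺))

    B⊆C⇒⊤⊆C : StepClosed C → B ⊆ C → a₀ ∈ C → a₁ ∈ C → ∀ v → v ∈ C
    B⊆C⇒⊤⊆C {C} closed B⊆C a₀∈C a₁∈C with 3 ≤? ∣ C ∩ A ∣
    ... | yes 3≤∣C∩A∣ = B⊆C⇒3≤∣C∩A∣⇒⊤⊆C closed B⊆C 3≤∣C∩A∣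
    ... | no  3≰∣C∩A∣ = ⊥-elim (low-pair-arith ∣ A - a₀ - a₁ ∣ 1+m≤k (begin
      k + (k + k * (2 + q))                            ≤⟨ ∑B⁺degA-lower ⟩
      ∑ B⁺ degA + 4                                    ≡⟨ cong (_+ 4) (∑∣N∩Q∣≡∑∣N∩P∣ G B⁺ A) ⟩
      ∑ A degB⁺ + 4                                    ≤⟨ +-monoˡ-≤ 4 ∑A-degB⁺-upper ⟩
      4 + q + (4 + q + ∣ A - a₀ - a₁ ∣ * (3 + q)) + 4  ∎))
      where
      open ≤-Reasoning
      degB⁺ : Fin n → ℕ
      degB⁺ a = ∣ N G a ∩ B⁺ ∣
      a₁∈A-a₀ : a₁ ∈ A - a₀
      a₁∈A-a₀ = x∈p∧x≢y⇒x∈p-y a₁∈A (≢-sym a₀≢a₁)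
      1+m≤k : suc ∣ A - a₀ - a₁ ∣ ≤ k
      1+m≤k = ≤-pred (≤-trans (s≤s (x∈p⇒∣p-x∣<∣p∣ a₁∈A-a₀))
                              (subst (∣ A - a₀ ∣ <_) ∣A∣≡1+k (x∈p⇒∣p-x∣<∣p∣ a₀∈A)))
      Pair⊆C : Pair ⊆ C
      Pair⊆C x∈Pair with x∈p∪q⁻ ⁅ a₀ ⁆ ⁅ a₁ ⁆ x∈Pair
      ... | inj₁ x∈⁅a₀⁆ = subst (_∈ C) (sym (x∈⁅y⁆⇒x≡y a₀ x∈⁅a₀⁆)) a₀∈C
      ... | inj₂ x∈⁅a₁⁆ = subst (_∈ C) (sym (x∈⁅y⁆⇒x≡y a₁ x∈⁅a₁⁆)) a₁∈C
      degB⁺≤3+q : a ∈ A - a₀ - a₁ → degB⁺ a ≤ 3 + q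
      degB⁺≤3+q {a} a∈A-a₀-a₁ =
        ≤-pred (≤-trans (s≤s (p⊆q⇒∣p∣≤∣q∣ N∩B⁺⊆N∩C)) (∉-StepClosed⇒∣N∩C∣<r closed a∉C))
        where
        a∈A-a₀ : a ∈ A - a₀
        a∈A-a₀ = p─q⊆p _ _ a∈A-a₀-a₁
        a∉C : a ∉ C
        a∉C a∈C = 3≰∣C∩A∣ (length≤∣q∣
          ((a₀≢a₁ ∷ ≢-sym (x∈p-y⇒x≢y a∈A-a₀) ∷ []) ∷ (≢-sym (x∈p-y⇒x≢y a∈A-a₀-a₁) ∷ []) ∷ [] ∷ [])
          (x∈p∩q⁺ (a₀∈C , a₀∈A) ∷ x∈p∩q⁺ (a₁∈C , a₁∈A) ∷ x∈p∩q⁺ (a∈C , p─q⊆p _ _ a∈A-a₀) ∷ []))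
        N∩B⁺⊆N∩C : N G a ∩ B⁺ ⊆ N G a ∩ C
        N∩B⁺⊆N∩C x∈ = let x∈N , x∈B⁺ = x∈p∩q⁻ (N G a) B⁺ x∈
                      in  x∈p∩q⁺ (x∈N , [ B⊆C , Pair⊆C ]′ (x∈p∪q⁻ B Pair x∈B⁺))
      ∑A-degB⁺-upper : ∑ A degB⁺ ≤ 4 + q + (4 + q + ∣ A - a₀ - a₁ ∣ * (3 + q))
      ∑A-degB⁺-upper = begin
        ∑ A degB⁺                                          ≡⟨ ∑-remove degB⁺ a₀∈A ⟩
        degB⁺ a₀ + ∑ (A - a₀) degB⁺                        ≡⟨ cong (degB⁺ a₀ +_) (∑-remove degB⁺ a₁∈A-a₀) ⟩
        degB⁺ a₀ + (degB⁺ a₁ + ∑ (A - a₀ - a₁) degB⁺)      ≤⟨ +-mono-≤ (∣N∩B⁺∣≤4+q a₀∈Pair (proj₂ low₀))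
                                                               (+-mono-≤ (∣N∩B⁺∣≤4+q (p─q⊆p _ _ a₁∈Pair-a₀) (proj₂ low₁))
                                                                         (∑-mono (A - a₀ - a₁) degB⁺≤3+q)) ⟩
        4 + q + (4 + q + ∑ (A - a₀ - a₁) (λ _ → 3 + q))    ≡⟨ cong (λ s → 4 + q + (4 + q + s))
                                                               (∑-const (A - a₀ - a₁) (3 + q)) ⟩
        4 + q + (4 + q + ∣ A - a₀ - a₁ ∣ * (3 + q))        ∎

  k≤∣B∣+0 : k ≤ ∣ B ∣ + 0
  k≤∣B∣+0 = ≤-reflexive (sym (trans (+-identityʳ ∣ B ∣) ∣B∣≡k))

  2+q+6≤k : 2 + q + 6 ≤ k
  2+q+6≤k = ≤-trans (≤-reflexive (+-comm (2 + q) 6)) (m+q≤k 8 _)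

  Rich : Subset n
  Rich = filter (λ a → a ∈? A ×-dec r ≤? degB a)

  ∈Rich⁻ : a ∈ Rich → a ∈ A × r ≤ degB a
  ∈Rich⁻ = ∈-filter⁻ (λ a → a ∈? A ×-dec r ≤? degB a)

  ∣A-x-y∣+2 : ∀ x y → suc k ≤ ∣ A - x - y ∣ + 2
  ∣A-x-y∣+2 x y = remove-lower-bound {p = A - x} y (remove-lower-bound {p = A} x
    (≤-reflexive (sym (trans (+-identityʳ ∣ A ∣) ∣A∣≡1+k))))

  seed-from-rich-pair : ∀ {z₁ z₂} → z₁ ∈ Rich → z₂ ∈ Rich → z₁ ≢ z₂ → Seed
  seed-from-rich-pair {z₁} {z₂} z₁∈Rich z₂∈Rich z₁≢z₂
    with bound⇒Nonempty {X = A - z₁ - z₂} (∣A-x-y∣+2 z₁ z₂) (s≤s (m≤k 2 _))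
  ... | a₀ , a₀∈A-z₁-z₂
    with 1≤∣p∣⇒Nonempty {p = NB a₀} (≤-trans (s≤s z≤n) (1+q≤degB (p─q⊆p _ _ (p─q⊆p _ _ a₀∈A-z₁-z₂))))
  ... | b₁ , b₁∈NBa₀
    with bound⇒Nonempty {X = NB b₁} (k≤degB+2 (p∩q⊆q _ _ b₁∈NBa₀)) (m≤k 3 _)
  ... | b₂ , b₂∈NBb₁ = core+2⇒Seed a₀ b₃ ∣S∣≡2+q spans
    where
    b₁∈Na₀ : b₁ ∈ N G a₀
    b₁∈Na₀ = p∩q⊆p _ _ b₁∈NBa₀
    b₁∈B : b₁ ∈ B
    b₁∈B = p∩q⊆q _ _ b₁∈NBa₀
    b₂∈Nb₁ : b₂ ∈ N G b₁
    b₂∈Nb₁ = p∩q⊆p _ _ b₂∈NBb₁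
    b₂∈B : b₂ ∈ B
    b₂∈B = p∩q⊆q _ _ b₂∈NBb₁
    a₀∈A : a₀ ∈ A
    a₀∈A = p─q⊆p _ _ (p─q⊆p _ _ a₀∈A-z₁-z₂)
    open Cherry (cherry {X = B} ⊆-refl k≤∣B∣+0 2+q+6≤k b₁∈B b₂∈B)
    spans : ∀ {C} → StepClosed C → S ⊆ C → a₀ ∈ C → b₃ ∈ C → ∀ v → v ∈ C
    spans {C} closed S⊆C a₀∈C b₃∈C =
      B⊆C⇒3≤∣C∩A∣⇒⊤⊆C closed B⊆C (length≤∣q∣
        ((x∈p-y⇒x≢y (p─q⊆p _ _ a₀∈A-z₁-z₂) ∷ x∈p-y⇒x≢y a₀∈A-z₁-z₂ ∷ []) ∷ (z₁≢z₂ ∷ []) ∷ [] ∷ [])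
        ( x∈p∩q⁺ (a₀∈C , a₀∈A)
        ∷ x∈p∩q⁺ (B⊆C⇒r≤degB⇒∈C closed B⊆C (proj₂ (∈Rich⁻ z₁∈Rich)) , proj₁ (∈Rich⁻ z₁∈Rich))
        ∷ x∈p∩q⁺ (B⊆C⇒r≤degB⇒∈C closed B⊆C (proj₂ (∈Rich⁻ z₂∈Rich)) , proj₁ (∈Rich⁻ z₂∈Rich)) ∷ []))
      where
      open Spread closed S⊆C S⊆B ∣S∣≡2+q
      b₁∈C : b₁ ∈ C
      b₁∈C = enter S⊆N₁ a₀∈C (∈N-sym G b₁∈Na₀) (A∉S a₀∈A) b₃∈C (∈N-sym G b₁∈N₃) (∉S S⊆N₃) (A≢B a₀∈A b₃∈B)
      b₂∈C : b₂ ∈ C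
      b₂∈C = enter S⊆N₂ b₁∈C (∈N-sym G b₂∈Nb₁) (∉S S⊆N₁) b₃∈C (∈N-sym G b₂∈N₃) (∉S S⊆N₃) (∈N⇒≢ G b₁∈N₃)
      B⊆C : B ⊆ C
      B⊆C = cherry⇒B⊆C b₁∈B b₂∈B b₃∈B S⊆N₁ S⊆N₂ S⊆N₃ b₁∈N₃ b₂∈N₃ (≢-sym (∈N⇒≢ G b₂∈Nb₁)) b₁∈C b₂∈C
  seed-from-B-hub : ∀ {b₁ a₀ a₁ b₂} → b₁ ∈ B → Hub b₁ a₀ a₁ → b₂ ∈ B → b₂ ≢ b₁ →
                    TwoOf b₁ a₀ a₁ b₂ → Seed
  seed-from-B-hub {b₁} {a₀} {a₁} {b₂} b₁∈B hub@(_ , _ , low₀ , low₁ , a₀≢a₁) b₂∈B b₂≢b₁ two =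
    core+2⇒Seed a₀ a₁ ∣S∣≡2+q λ {C} closed S⊆C a₀∈C a₁∈C →
      let open Spread closed S⊆C S⊆B ∣S∣≡2+q
          b₁∈C : b₁ ∈ C
          b₁∈C = hub∈C S⊆N₁ hub a₀∈C a₁∈C
          b₂∈C : b₂ ∈ C
          b₂∈C = TwoOf⇒∈C S⊆N₁ S⊆N₂ hub b₁∈C a₀∈C a₁∈C two
      in  LowPair.B⊆C⇒⊤⊆C a₀≢a₁ low₀ low₁ closed
            (cherry⇒B⊆C b₁∈B b₂∈B b₃∈B S⊆N₁ S⊆N₂ S⊆N₃ b₁∈N₃ b₂∈N₃ (≢-sym b₂≢b₁) b₁∈C b₂∈C)
            a₀∈C a₁∈C
    where open Cherry (cherry ⊆-refl k≤∣B∣+0 2+q+6≤k b₁∈B b₂∈B)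

  seed-from-A-hub : ∀ {z a₀ a₁ b₁} → z ∈ A → Hub z a₀ a₁ → 8 + q ≤ degB z → b₁ ∈ B →
                    TwoOf z a₀ a₁ b₁ → Seed
  seed-from-A-hub {z} {a₀} {a₁} {b₁} z∈A hub@(_ , _ , low₀ , low₁ , a₀≢a₁) 8+q≤degB b₁∈B two =
    let b₂ , b₂∈ = bound⇒Nonempty (∩NB-lower-bound {X = NB z} (p∩q⊆q _ _) 8+q≤degB+0 b₁∈B)
                                  (≤-trans (s≤s (s≤s (s≤s z≤n))) (m≤m+n 8 q))
    in  spans b₂∈
    where
    8+q≤degB+0 : 8 + q ≤ degB z + 0
    8+q≤degB+0 = subst (8 + q ≤_) (sym (+-identityʳ (degB z))) 8+q≤degB
    spans : ∀ {b₂} → b₂ ∈ NB z ∩ NB b₁ → Seed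
    spans {b₂} b₂∈ = core+2⇒Seed a₀ a₁ ∣S∣≡2+q λ {C} closed S⊆C a₀∈C a₁∈C →
      let open Spread closed S⊆C S⊆B ∣S∣≡2+q
          S⊆Nz : S ⊆ N G z
          S⊆Nz = p∩q⊆p _ _ ∘ S⊆X
          z∈C : z ∈ C
          z∈C = hub∈C S⊆Nz hub a₀∈C a₁∈C
          b₁∈C : b₁ ∈ C
          b₁∈C = TwoOf⇒∈C S⊆Nz S⊆N₁ hub z∈C a₀∈C a₁∈C two
          b₂∈C : b₂ ∈ C
          b₂∈C = enter S⊆N₂ b₁∈C (∈N-sym G b₂∈Nb₁) (∉S S⊆N₁) z∈C (∈N-sym G b₂∈Nz) (A∉S z∈A)
                   (≢-sym (A≢B z∈A b₁∈B))
      in  LowPair.B⊆C⇒⊤⊆C a₀≢a₁ low₀ low₁ closed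
            (cherry⇒B⊆C b₁∈B b₂∈B b₃∈B S⊆N₁ S⊆N₂ S⊆N₃ b₁∈N₃ b₂∈N₃ (≢-sym (∈N⇒≢ G b₂∈Nb₁)) b₁∈C b₂∈C)
            a₀∈C a₁∈C
      where
      b₂∈Nz : b₂ ∈ N G z
      b₂∈Nz = p∩q⊆p _ _ (p∩q⊆p _ _ b₂∈)
      b₂∈Nb₁ : b₂ ∈ N G b₁
      b₂∈Nb₁ = p∩q⊆p _ _ (p∩q⊆q _ _ b₂∈)
      b₂∈B : b₂ ∈ B
      b₂∈B = p∩q⊆q _ _ (p∩q⊆q _ _ b₂∈)
      open Cherry (cherry {X = NB z} {e = 0} (p∩q⊆q _ _) 8+q≤degB+0 (≤-reflexive (+-comm (2 + q) 6)) b₁∈B b₂∈B)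

  Low? : ∀ a → Dec (Low a)
  Low? a = a ∈? A ×-dec degB a ≤? 3 + q

  BHubConfig : Set
  BHubConfig = ∃ λ b₁ → ∃ λ a₀ → ∃ λ a₁ → ∃ λ b₂ →
    b₁ ∈ B × Hub b₁ a₀ a₁ × b₂ ∈ B × b₂ ≢ b₁ × TwoOf b₁ a₀ a₁ b₂

  BHubConfig? : Dec BHubConfig
  BHubConfig? = any? λ b₁ → any? λ a₀ → any? λ a₁ → any? λ b₂ →
    b₁ ∈? B ×-dec
    (a₀ ∈? N G b₁ ×-dec a₁ ∈? N G b₁ ×-dec Low? a₀ ×-dec Low? a₁ ×-dec ¬? (a₀ ≟ a₁)) ×-dec
    b₂ ∈? B ×-dec ¬? (b₂ ≟ b₁) ×-dec
    ((b₂ ∈? N G a₀ ×-dec b₂ ∈? N G a₁) ⊎-dec (b₂ ∈? N G b₁ ×-dec (b₂ ∈? N G a₀ ⊎-dec b₂ ∈? N G a₁)))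

  seed-from-BHubConfig : BHubConfig → Seed
  seed-from-BHubConfig (_ , _ , _ , _ , b₁∈B , hub , b₂∈B , b₂≢b₁ , two) =
    seed-from-B-hub b₁∈B hub b₂∈B b₂≢b₁ two

  ≤1-non-neighbour-in-B : ∀ {c₀ c₁} → b ∈ B → c₀ ∈ B → c₁ ∈ B → c₀ ≢ b → c₁ ≢ b → c₀ ≢ c₁ →
                          c₀ ∉ N G b → c₁ ∉ N G b → ⊥₀
  ≤1-non-neighbour-in-B {b} b∈B c₀∈B c₁∈B c₀≢b c₁≢b c₀≢c₁ c₀∉N c₁∉N =
    <⇒≱ (begin-strict
      degB b + 2  <⟨ +-monoʳ-< (degB b) ≤-refl ⟩
      degB b + 3  ≤⟨ ∣p∣+length≤∣q∣ (p∩q⊆q _ _)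
                       ((≢-sym c₀≢b ∷ ≢-sym c₁≢b ∷ []) ∷ (c₀≢c₁ ∷ []) ∷ [] ∷ [])
                       ( (b∈B , x∉N[x] G ∘ p∩q⊆p _ _)
                       ∷ (c₀∈B , c₀∉N ∘ p∩q⊆p _ _) ∷ (c₁∈B , c₁∉N ∘ p∩q⊆p _ _) ∷ []) ⟩
      ∣ B ∣       ≡⟨ ∣B∣≡k ⟩
      k           ∎) (k≤degB+2 b∈B)
    where open ≤-Reasoning

  hub⇒BHubConfig : ∀ {a₀ a₁} → b ∈ B → Hub b a₀ a₁ → 2 ≤ degB a₀ → 2 ≤ degB a₁ → BHubConfig
  hub⇒BHubConfig {b} {a₀} {a₁} b∈B hub 2≤degB₀ 2≤degB₁ =
    let c₀ , c₀∈NBa₀ , c₀≢b = 2≤∣p∣⇒∃≢ 2≤degB₀ b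
        c₁ , c₁∈NBa₁ , c₁≢b = 2≤∣p∣⇒∃≢ 2≤degB₁ b
    in  pick c₀∈NBa₀ c₀≢b c₁∈NBa₁ c₁≢b
    where
    config : ∀ {c} → c ∈ B → c ≢ b → TwoOf b a₀ a₁ c → BHubConfig
    config c∈B c≢b two = _ , _ , _ , _ , b∈B , hub , c∈B , c≢b , two
    pick : ∀ {c₀ c₁} → c₀ ∈ NB a₀ → c₀ ≢ b → c₁ ∈ NB a₁ → c₁ ≢ b → BHubConfig
    pick {c₀} {c₁} c₀∈NBa₀ c₀≢b c₁∈NBa₁ c₁≢b with c₀ ∈? N G b | c₁ ∈? N G b | c₀ ≟ c₁
    ... | yes c₀∈Nb | _         | _         = config c₀∈B c₀≢b (inj₂ (c₀∈Nb , inj₁ c₀∈Na₀))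
      where c₀∈Na₀ = p∩q⊆p _ _ c₀∈NBa₀ ; c₀∈B = p∩q⊆q _ _ c₀∈NBa₀
    ... | no _      | yes c₁∈Nb | _         = config (p∩q⊆q _ _ c₁∈NBa₁) c₁≢b (inj₂ (c₁∈Nb , inj₂ (p∩q⊆p _ _ c₁∈NBa₁)))
    ... | no _      | no _      | yes refl  = config (p∩q⊆q _ _ c₀∈NBa₀) c₀≢b (inj₁ (p∩q⊆p _ _ c₀∈NBa₀ , p∩q⊆p _ _ c₁∈NBa₁))
    ... | no c₀∉Nb  | no c₁∉Nb  | no c₀≢c₁  =
      ⊥-elim (≤1-non-neighbour-in-B b∈B (p∩q⊆q _ _ c₀∈NBa₀) (p∩q⊆q _ _ c₁∈NBa₁) c₀≢b c₁≢b c₀≢c₁ c₀∉Nb c₁∉Nb)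

  ∉Rich⇒Low : a ∈ A → a ∉ Rich → Low a
  ∉Rich⇒Low {a} a∈A a∉Rich with r ≤? degB a
  ... | yes r≤degB = contradiction (∈-filter⁺ (λ a → a ∈? A ×-dec r ≤? degB a) (a∈A , r≤degB)) a∉Rich
  ... | no  r≰degB = a∈A , ≤-pred (≰⇒> r≰degB)

  ∣Rich∣≤1⇒Hub : ∣ Rich ∣ ≤ 1 → 3 ≤ degA b → ∃ λ a₀ → ∃ λ a₁ → Hub b a₀ a₁
  ∣Rich∣≤1⇒Hub {b} ∣Rich∣≤1 3≤degA =
    let a₀ , a₁ , a₀∈L , a₁∈L , a₀≢a₁ = 2≤∣p∣⇒∃₂≢ 2≤∣X∣
    in  a₀ , a₁ , N∩A⊆N (p∩q⊆p _ _ a₀∈L) , N∩A⊆N (p∩q⊆p _ _ a₁∈L) , low a₀∈L , low a₁∈L , a₀≢a₁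
    where
    L : Subset n
    L = (N G b ∩ A) ∩ ∁ Rich
    N∩A⊆N : N G b ∩ A ⊆ N G b
    N∩A⊆N = p∩q⊆p _ _
    low : ∀ {a} → a ∈ L → Low a
    low a∈L = ∉Rich⇒Low (p∩q⊆q _ _ (p∩q⊆p _ _ a∈L)) (x∈∁p⇒x∉p (p∩q⊆q _ _ a∈L))
    2≤∣X∣ : 2 ≤ ∣ L ∣
    2≤∣X∣ = +-cancelˡ-≤ 1 2 ∣ L ∣ (begin
      3                                   ≤⟨ 3≤degA ⟩
      degA b                              ≡⟨ ∣p∣≡∣p∩q∣+∣p∩∁q∣ (N G b ∩ A) Rich ⟩
      ∣ (N G b ∩ A) ∩ Rich ∣ + ∣ L ∣      ≤⟨ +-monoˡ-≤ ∣ L ∣ (≤-trans (∣p∩q∣≤∣q∣ (N G b ∩ A) Rich) ∣Rich∣≤1) ⟩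
      1 + ∣ L ∣                           ∎)
      where open ≤-Reasoning

  BHubConfig-if-r≥5 : 1 ≤ q → ∣ Rich ∣ ≤ 1 → BHubConfig
  BHubConfig-if-r≥5 1≤q ∣Rich∣≤1 =
    let b , b∈B = 1≤∣p∣⇒Nonempty (subst (1 ≤_) (sym ∣B∣≡k) (m≤k 1 _))
        a₀ , a₁ , hub@(_ , _ , (a₀∈A , _) , (a₁∈A , _) , _) =
          ∣Rich∣≤1⇒Hub ∣Rich∣≤1 (≤-trans (s≤s (s≤s 1≤q)) (2+q≤degA b∈B))
    in  hub⇒BHubConfig b∈B hub (≤-trans (s≤s 1≤q) (1+q≤degB a₀∈A)) (≤-trans (s≤s 1≤q) (1+q≤degB a₁∈A))

  seed-or-sparse : Seed ⊎ (∣ Rich ∣ ≤ 1 × ¬ BHubConfig)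
  seed-or-sparse with 2 ≤? ∣ Rich ∣ | BHubConfig?
  ... | yes 2≤∣Rich∣ | _ = let z₁ , z₂ , z₁∈ , z₂∈ , z₁≢z₂ = 2≤∣p∣⇒∃₂≢ 2≤∣Rich∣
                           in  inj₁ (seed-from-rich-pair z₁∈ z₂∈ z₁≢z₂)
  ... | no  2≰∣Rich∣ | yes config = inj₁ (seed-from-BHubConfig config)
  ... | no  2≰∣Rich∣ | no ¬config = inj₂ (≤-pred (≰⇒> 2≰∣Rich∣) , ¬config)

-- The case r = 4

module Setting₄ {k : ℕ} (G : Graph (2 * k + 1)) (A : Subset (2 * k + 1))
  (24≤k : 24 + 0 ≤ k)
  (δ≥k+1 : MinDegreeAtLeast G (k + 1))
  (∣A∣≡1+k : ∣ A ∣ ≡ suc k)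
  (A-stepClosed : Bootstrap.StepClosed G 4 A)
  where

  open Setting G A 24≤k δ≥k+1 ∣A∣≡1+k A-stepClosed

  k+k≡k*2 : ∀ k → k + k ≡ k * 2
  k+k≡k*2 = solve-∀

  private variable
    a a′ b c : Fin n

  Poor : Subset n
  Poor = filter (λ a → a ∈? A ×-dec degB a ≤? 1)

  ∈Poor⁻ : a ∈ Poor → a ∈ A × degB a ≤ 1
  ∈Poor⁻ = ∈-filter⁻ (λ a → a ∈? A ×-dec degB a ≤? 1)

  ∉Poor⇒2≤degB : a ∈ A → a ∉ Poor → 2 ≤ degB a
  ∉Poor⇒2≤degB {a} a∈A a∉Poor with degB a ≤? 1
  ... | yes degB≤1 = contradiction (∈-filter⁺ (λ a → a ∈? A ×-dec degB a ≤? 1) (a∈A , degB≤1)) a∉Poor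
  ... | no  degB≰1 = ≰⇒> degB≰1

  Poor⇒Low : a ∈ Poor → Low a
  Poor⇒Low a∈Poor = let a∈A , degB≤1 = ∈Poor⁻ a∈Poor in a∈A , ≤-trans degB≤1 (s≤s z≤n)

  Poor⇒adjacent-to-A : a ∈ Poor → a′ ∈ A → a′ ≢ a → a′ ∈ N G a
  Poor⇒adjacent-to-A {a} a∈Poor a′∈A a′≢a =
    ∣X-v∣≤∣N∩X∣⇒X-v⊆N G (≤-trans ∣A-a∣≤k k≤degA) (x∈p∧x≢y⇒x∈p-y a′∈A a′≢a)
    where
    a∈A : a ∈ A
    a∈A = proj₁ (∈Poor⁻ a∈Poor)
    ∣A-a∣≤k : ∣ A - a ∣ ≤ k
    ∣A-a∣≤k = ≤-pred (subst (∣ A - a ∣ <_) ∣A∣≡1+k (x∈p⇒∣p-x∣<∣p∣ a∈A))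
    k≤degA : k ≤ degA a
    k≤degA = +-cancelʳ-≤ 1 k (degA a) (≤-trans (δ≥k+1 a)
      (≤-trans (≤-reflexive (degree≡degA+degB a)) (+-monoʳ-≤ (degA a) (proj₂ (∈Poor⁻ a∈Poor)))))

  degA≤2⇒adjacent-to-B : b ∈ B → degA b ≤ 2 → c ∈ B → c ≢ b → c ∈ N G b
  degA≤2⇒adjacent-to-B {b} b∈B degA≤2 c∈B c≢b =
    ∣X-v∣≤∣N∩X∣⇒X-v⊆N G ∣B-b∣≤degB (x∈p∧x≢y⇒x∈p-y c∈B c≢b)
    where
    open ≤-Reasoning
    ∣B-b∣≤degB : ∣ B - b ∣ ≤ degB b
    ∣B-b∣≤degB = ≤-pred (begin
      suc ∣ B - b ∣     ≤⟨ subst (∣ B - b ∣ <_) ∣B∣≡k (x∈p⇒∣p-x∣<∣p∣ b∈B) ⟩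
      k                 ≤⟨ +-cancelʳ-≤ 1 k (1 + degB b) (begin
                             k + 1             ≤⟨ δ≥k+1 b ⟩
                             degree G b        ≡⟨ degree≡degA+degB b ⟩
                             degA b + degB b   ≤⟨ +-monoˡ-≤ (degB b) degA≤2 ⟩
                             2 + degB b        ≡⟨ +-comm (1 + degB b) 1 ⟨
                             1 + degB b + 1    ∎) ⟩
      1 + degB b        ∎)

  ∑∣N∩Poor∣≤∣Poor∣ : ∑ B (λ b → ∣ N G b ∩ Poor ∣) ≤ ∣ Poor ∣
  ∑∣N∩Poor∣≤∣Poor∣ = begin
    ∑ B (λ b → ∣ N G b ∩ Poor ∣)   ≡⟨ ∑∣N∩Q∣≡∑∣N∩P∣ G B Poor ⟩
    ∑ Poor degB                    ≤⟨ ∑-mono Poor (proj₂ ∘ ∈Poor⁻) ⟩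
    ∑ Poor (λ _ → 1)               ≡⟨ trans (∑-const Poor 1) (*-identityʳ ∣ Poor ∣) ⟩
    ∣ Poor ∣                       ∎
    where open ≤-Reasoning

  ∣Poor∣≤1+k : ∣ Poor ∣ ≤ suc k
  ∣Poor∣≤1+k = subst (∣ Poor ∣ ≤_) ∣A∣≡1+k (p⊆q⇒∣p∣≤∣q∣ (proj₁ ∘ ∈Poor⁻))

  Rich≢Poor : ∀ {z} → z ∈ Rich → a ∈ Poor → z ≢ a
  Rich≢Poor z∈Rich a∈Poor refl = contradiction (≤-trans (proj₂ (∈Rich⁻ z∈Rich)) (proj₂ (∈Poor⁻ a∈Poor)))
                                               (<⇒≱ (≤ᵇ⇒≤ 2 4 _))

  2≤degB+𝟙Poor : a ∈ A → 2 ≤ degB a + 𝟙 Poor a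
  2≤degB+𝟙Poor {a} a∈A with a ∈? Poor
  ... | yes a∈Poor = subst (λ i → 2 ≤ degB a + i) (sym (∈⇒𝟙≡1 a∈Poor)) (+-monoˡ-≤ 1 (1+q≤degB a∈A))
  ... | no  a∉Poor = ≤-trans (∉Poor⇒2≤degB a∈A a∉Poor) (m≤m+n (degB a) _)

  k*2≤∑degB+∣Poor∣ : ∀ {z} → z ∈ A → k * 2 ≤ ∑ (A - z) degB + ∣ Poor ∣
  k*2≤∑degB+∣Poor∣ {z} z∈A = begin
    k * 2                                           ≤⟨ *-monoˡ-≤ 2 k≤∣A-z∣ ⟩
    ∣ A - z ∣ * 2                                   ≡⟨ ∑-const (A - z) 2 ⟨
    ∑ (A - z) (λ _ → 2)                             ≤⟨ ∑-mono (A - z) (2≤degB+𝟙Poor ∘ p─q⊆p _ _) ⟩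
    ∑ (A - z) (λ a → degB a + 𝟙 Poor a)             ≡⟨ ∑-distrib-+ (A - z) ⟩
    ∑ (A - z) degB + ∑ (A - z) (𝟙 Poor)             ≡⟨ cong (∑ (A - z) degB +_) (∑-𝟙 (A - z) Poor) ⟩
    ∑ (A - z) degB + ∣ (A - z) ∩ Poor ∣             ≤⟨ +-monoʳ-≤ (∑ (A - z) degB) (∣p∩q∣≤∣q∣ (A - z) Poor) ⟩
    ∑ (A - z) degB + ∣ Poor ∣                       ∎
    where
    open ≤-Reasoning
    k≤∣A-z∣ : k ≤ ∣ A - z ∣
    k≤∣A-z∣ = ≤-pred (subst (_≤ suc ∣ A - z ∣) ∣A∣≡1+k (∣p∣≤1+∣p-x∣ A z))

  module Sparse (∣Rich∣≤1 : ∣ Rich ∣ ≤ 1) (¬config : ¬ BHubConfig) where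

    hub⇒Poor : ∀ {a₀ a₁} → b ∈ B → Hub b a₀ a₁ → a₀ ∈ Poor ⊎ a₁ ∈ Poor
    hub⇒Poor {b} {a₀} {a₁} b∈B hub@(_ , _ , (a₀∈A , _) , (a₁∈A , _) , _) with a₀ ∈? Poor | a₁ ∈? Poor
    ... | yes a₀∈Poor | _            = inj₁ a₀∈Poor
    ... | no  _       | yes a₁∈Poor  = inj₂ a₁∈Poor
    ... | no  a₀∉Poor | no  a₁∉Poor  =
      ⊥-elim (¬config (hub⇒BHubConfig b∈B hub (∉Poor⇒2≤degB a₀∈A a₀∉Poor) (∉Poor⇒2≤degB a₁∈A a₁∉Poor)))

    Rich-unique : ∀ {z z′} → z ∈ Rich → z′ ∈ Rich → z′ ≡ z
    Rich-unique {z} {z′} z∈Rich z′∈Rich with z′ ≟ z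
    ... | yes z′≡z = z′≡z
    ... | no  z′≢z = contradiction (length≤∣q∣ ((z′≢z ∷ []) ∷ [] ∷ []) (z′∈Rich ∷ z∈Rich ∷ []))
                                   (<⇒≱ (s≤s ∣Rich∣≤1))

    NoRichNeighbour : Fin n → Set
    NoRichNeighbour b = ∀ {z} → z ∈ Rich → z ∉ N G b

    2≤∣N∩Poor∣ : b ∈ B → NoRichNeighbour b → 2 ≤ ∣ N G b ∩ Poor ∣
    2≤∣N∩Poor∣ {b} b∈B noRich =
      let a , a′ , a∈N∩A , a′∈N∩A , a≢a′ = 2≤∣p∣⇒∃₂≢ (2+q≤degA b∈B)
          a∈N , a∈A = x∈p∩q⁻ (N G b) A a∈N∩A
          a′∈N , a′∈A = x∈p∩q⁻ (N G b) A a′∈N∩A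
      in  [ (λ a∈Poor → one-Poor a∈Poor a∈N a′∈N a′∈A (≢-sym a≢a′))
          , (λ a′∈Poor → one-Poor a′∈Poor a′∈N a∈N a∈A a≢a′)
          ]′ (hub⇒Poor b∈B (a∈N , a′∈N , low a∈N a∈A , low a′∈N a′∈A , a≢a′))
      where
      low : a ∈ N G b → a ∈ A → Low a
      low a∈N a∈A = ∉Rich⇒Low a∈A (λ a∈Rich → noRich a∈Rich a∈N)
      two-Poor : ∀ {a a′} → a ∈ N G b → a ∈ Poor → a′ ∈ N G b → a′ ∈ Poor → a ≢ a′ → 2 ≤ ∣ N G b ∩ Poor ∣
      two-Poor a∈N a∈Poor a′∈N a′∈Poor a≢a′ =
        length≤∣q∣ ((a≢a′ ∷ []) ∷ [] ∷ []) (x∈p∩q⁺ (a∈N , a∈Poor) ∷ x∈p∩q⁺ (a′∈N , a′∈Poor) ∷ [])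
      one-Poor : a ∈ Poor → a ∈ N G b → a′ ∈ N G b → a′ ∈ A → a′ ≢ a → 2 ≤ ∣ N G b ∩ Poor ∣
      one-Poor {a} {a′} a∈Poor a∈N a′∈N a′∈A a′≢a with a′ ∈? Poor | 3 ≤? degA b
      ... | yes a′∈Poor | _ = two-Poor a∈N a∈Poor a′∈N a′∈Poor (≢-sym a′≢a)
      ... | no  a′∉Poor | yes 3≤degA =
        let a″ , a″∈ = bound⇒Nonempty {X = N G b ∩ A - a - a′}
                         (remove-lower-bound {p = N G b ∩ A - a} a′ (remove-lower-bound {p = N G b ∩ A} a
                           (subst (3 ≤_) (sym (+-identityʳ (degA b))) 3≤degA)))
                         ≤-refl
            a″∈N∩A-a : a″ ∈ N G b ∩ A - a
            a″∈N∩A-a = p─q⊆p _ _ a″∈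
            a″∈N , a″∈A = x∈p∩q⁻ (N G b) A (p─q⊆p _ _ a″∈N∩A-a)
            hub′ : Hub b a′ a″
            hub′ = a′∈N , a″∈N , low a′∈N a′∈A , low a″∈N a″∈A , ≢-sym (x∈p-y⇒x≢y a″∈)
        in  [ (λ a′∈Poor → contradiction a′∈Poor a′∉Poor)
            , (λ a″∈Poor → two-Poor a∈N a∈Poor a″∈N a″∈Poor (≢-sym (x∈p-y⇒x≢y a″∈N∩A-a)))
            ]′ (hub⇒Poor b∈B hub′)
      ... | no  a′∉Poor | no  3≰degA =
        let c , c∈NBa′ , c≢b = 2≤∣p∣⇒∃≢ (∉Poor⇒2≤degB a′∈A a′∉Poor) b
            c∈Na′ , c∈B = x∈p∩q⁻ (N G a′) B c∈NBa′
            c∈Nb : c ∈ N G b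
            c∈Nb = degA≤2⇒adjacent-to-B b∈B (≤-pred (≰⇒> 3≰degA)) c∈B c≢b
        in  ⊥-elim (¬config (b , a′ , a , c , b∈B ,
                             (a′∈N , a∈N , low a′∈N a′∈A , Poor⇒Low a∈Poor , a′≢a) ,
                             c∈B , c≢b , inj₂ (c∈Nb , inj₁ c∈Na′)))

    no-Rich-impossible : ¬ (1 ≤ ∣ Rich ∣) → ⊥₀
    no-Rich-impossible ∣Rich∣≢0 = contradiction (+-cancelˡ-≤ k k 1 k+k≤k+1) (<⇒≱ (m≤k 2 _))
      where
      open ≤-Reasoning
      noRich : NoRichNeighbour b
      noRich z∈Rich _ = ∣Rich∣≢0 (length≤∣q∣ ([] ∷ []) (z∈Rich ∷ []))
      k+k≤k+1 : k + k ≤ k + 1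
      k+k≤k+1 = begin
        k + k                          ≡⟨ k+k≡k*2 k ⟩
        k * 2                          ≡⟨ cong (_* 2) ∣B∣≡k ⟨
        ∣ B ∣ * 2                      ≡⟨ ∑-const B 2 ⟨
        ∑ B (λ _ → 2)                  ≤⟨ ∑-mono B (λ b∈B → 2≤∣N∩Poor∣ b∈B noRich) ⟩
        ∑ B (λ b → ∣ N G b ∩ Poor ∣)   ≤⟨ ≤-trans ∑∣N∩Poor∣≤∣Poor∣ ∣Poor∣≤1+k ⟩
        suc k                          ≡⟨ +-comm 1 k ⟩
        k + 1                          ∎

    Far : Fin n → Subset n
    Far z = B ∩ ∁ (N G z)

    Far⇒NoRichNeighbour : ∀ {z} → z ∈ Rich → b ∈ Far z → NoRichNeighbour b
    Far⇒NoRichNeighbour z∈Rich b∈Far z′∈Rich z′∈Nb with Rich-unique z∈Rich z′∈Rich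
    ... | refl = x∈∁p⇒x∉p (p∩q⊆q _ _ b∈Far) (∈N-sym G z′∈Nb)

    -- Each vertex of B far from z has two poor neighbours, each poor vertex has only one
    -- neighbour in B, so fewer than (k + 1)/2 vertices of B are far from z.
    8≤degB : ∀ {z} → z ∈ Rich → 8 ≤ degB z
    8≤degB {z} z∈Rich with 8 ≤? degB z
    ... | yes 8≤ = 8≤
    ... | no  8≰ = contradiction (≤-trans (m≤k 16 _) k≤2d+1) (<⇒≱ (s≤s (+-mono-≤ (+-mono-≤ d≤7 d≤7) ≤-refl)))
      where
      open ≤-Reasoning
      d e : ℕ
      d = degB z
      e = ∣ Far z ∣
      d≤7 : d ≤ 7
      d≤7 = ≤-pred (≰⇒> 8≰)
      k≤d+e : k ≤ d + e
      k≤d+e = begin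
        k                             ≡⟨ ∣B∣≡k ⟨
        ∣ B ∣                         ≡⟨ ∣p∣≡∣p∩q∣+∣p∩∁q∣ B (N G z) ⟩
        ∣ B ∩ N G z ∣ + e             ≡⟨ cong (λ X → ∣ X ∣ + e) (∩-comm B (N G z)) ⟩
        d + e                         ∎
      e*2≤1+k : e * 2 ≤ suc k
      e*2≤1+k = begin
        e * 2                         ≡⟨ ∑-const (Far z) 2 ⟨
        ∑ (Far z) (λ _ → 2)           ≤⟨ ∑-mono (Far z) (λ b∈Far → 2≤∣N∩Poor∣ (p∩q⊆p _ _ b∈Far)
                                                           (Far⇒NoRichNeighbour z∈Rich b∈Far)) ⟩
        ∑ (Far z) (λ b → ∣ N G b ∩ Poor ∣) ≤⟨ ∑-mono-⊆ (λ b → ∣ N G b ∩ Poor ∣) (p∩q⊆p B (∁ (N G z))) ⟩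
        ∑ B (λ b → ∣ N G b ∩ Poor ∣)  ≤⟨ ≤-trans ∑∣N∩Poor∣≤∣Poor∣ ∣Poor∣≤1+k ⟩
        suc k                         ∎
      k≤2d+1 : k ≤ d + d + 1
      k≤2d+1 = +-cancelʳ-≤ k k (d + d + 1) (begin
        k + k                         ≤⟨ +-mono-≤ k≤d+e k≤d+e ⟩
        (d + e) + (d + e)             ≡⟨ regroup d e ⟩
        (d + d) + e * 2               ≤⟨ +-monoʳ-≤ (d + d) e*2≤1+k ⟩
        (d + d) + suc k               ≡⟨ +-assoc (d + d) 1 k ⟨
        d + d + 1 + k                 ∎)
        where
        regroup : ∀ d p → (d + p) + (d + p) ≡ (d + d) + p * 2
        regroup = solve-∀

    seed-from-Far : ∀ {z} → z ∈ Rich → b ∈ Far z → Seed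
    seed-from-Far {b} {z} z∈Rich b∈Far =
      let a₀ , a₁ , a₀∈ , a₁∈ , a₀≢a₁ = 2≤∣p∣⇒∃₂≢ (2≤∣N∩Poor∣ b∈B (Far⇒NoRichNeighbour z∈Rich b∈Far))
          a₀∈Nb , a₀∈Poor = x∈p∩q⁻ (N G b) Poor a₀∈
          a₁∈Nb , a₁∈Poor = x∈p∩q⁻ (N G b) Poor a₁∈
      in  seed-from-A-hub z∈A (near a₀∈Poor , near a₁∈Poor , Poor⇒Low a₀∈Poor , Poor⇒Low a₁∈Poor , a₀≢a₁)
                          (8≤degB z∈Rich) b∈B (inj₁ (∈N-sym G a₀∈Nb , ∈N-sym G a₁∈Nb))
      where
      b∈B : b ∈ B
      b∈B = p∩q⊆p _ _ b∈Far
      z∈A : z ∈ A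
      z∈A = proj₁ (∈Rich⁻ z∈Rich)
      near : ∀ {a} → a ∈ Poor → a ∈ N G z
      near a∈Poor = ∈N-sym G (Poor⇒adjacent-to-A a∈Poor z∈A (Rich≢Poor z∈Rich a∈Poor))

    Far-empty⇒B⊆N : ∀ {z} → ¬ (1 ≤ ∣ Far z ∣) → B ⊆ N G z
    Far-empty⇒B⊆N {z} ∣Far∣≢0 {b} b∈B with b ∈? N G z
    ... | yes b∈N = b∈N
    ... | no  b∉N = contradiction (length≤∣q∣ ([] ∷ []) (x∈p∩q⁺ (b∈B , x∉p⇒x∈∁p b∉N) ∷ [])) ∣Far∣≢0

    near-Low : ∀ {z} → z ∈ Rich → a ∈ N G z → a ∈ A → Low a
    near-Low z∈Rich a∈Nz a∈A = ∉Rich⇒Low a∈A (λ a∈Rich → ∈N⇒≢ G a∈Nz (Rich-unique z∈Rich a∈Rich))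

    seed-from-A-neighbours : ∀ {z} → z ∈ Rich → B ⊆ N G z → 2 ≤ ∣ N G z ∩ A ∣ → Seed
    seed-from-A-neighbours {z} z∈Rich B⊆Nz 2≤∣N∩A∣ =
      let a₀ , a₁ , a₀∈ , a₁∈ , a₀≢a₁ = 2≤∣p∣⇒∃₂≢ 2≤∣N∩A∣
          a₀∈Nz , a₀∈A = x∈p∩q⁻ (N G z) A a₀∈
          a₁∈Nz , a₁∈A = x∈p∩q⁻ (N G z) A a₁∈
          b₁ , b₁∈NBa₀ = 1≤∣p∣⇒Nonempty {p = NB a₀} (1+q≤degB a₀∈A)
          b₁∈Na₀ , b₁∈B = x∈p∩q⁻ (N G a₀) B b₁∈NBa₀
      in  seed-from-A-hub (proj₁ (∈Rich⁻ z∈Rich))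
            (a₀∈Nz , a₁∈Nz , near-Low z∈Rich a₀∈Nz a₀∈A , near-Low z∈Rich a₁∈Nz a₁∈A , a₀≢a₁)
            (8≤degB z∈Rich) b₁∈B (inj₂ (B⊆Nz b₁∈B , inj₁ b₁∈Na₀))

    degA≤2+∣N∩Poor∣ : b ∈ B → degA b ≤ 2 + ∣ N G b ∩ Poor ∣
    degA≤2+∣N∩Poor∣ {b} b∈B with 3 ≤? degA b
    ... | no  3≰degA = ≤-trans (≤-pred (≰⇒> 3≰degA)) (m≤m+n 2 _)
    ... | yes 3≤degA =
      let a₀ , a₁ , hub@(a₀∈Nb , a₁∈Nb , _) = ∣Rich∣≤1⇒Hub ∣Rich∣≤1 3≤degA
      in  ≤-trans (degA≤3+q b∈B) (+-monoʳ-≤ 2 ([ poor-neighbour a₀∈Nb , poor-neighbour a₁∈Nb ]′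
                                                (hub⇒Poor b∈B hub)))
      where
      poor-neighbour : a ∈ N G b → a ∈ Poor → 1 ≤ ∣ N G b ∩ Poor ∣
      poor-neighbour a∈Nb a∈Poor = length≤∣q∣ ([] ∷ []) (x∈p∩q⁺ (a∈Nb , a∈Poor) ∷ [])

    ∑degA≤k*2+∣Poor∣ : ∑ B degA ≤ k * 2 + ∣ Poor ∣
    ∑degA≤k*2+∣Poor∣ = begin
      ∑ B degA                                      ≤⟨ ∑-mono B degA≤2+∣N∩Poor∣ ⟩
      ∑ B (λ b → 2 + ∣ N G b ∩ Poor ∣)              ≡⟨ ∑-distrib-+ B ⟩
      ∑ B (λ _ → 2) + ∑ B (λ b → ∣ N G b ∩ Poor ∣)  ≤⟨ +-mono-≤ (≤-reflexive (trans (∑-const B 2) (cong (_* 2) ∣B∣≡k)))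
                                                                ∑∣N∩Poor∣≤∣Poor∣ ⟩
      k * 2 + ∣ Poor ∣                              ∎
      where open ≤-Reasoning

    A-non-neighbours-impossible : ∀ {z} → z ∈ Rich → B ⊆ N G z → ∣ N G z ∩ A ∣ ≤ 1 → ⊥₀
    A-non-neighbours-impossible {z} z∈Rich B⊆Nz ∣N∩A∣≤1 =
      contradiction (+-cancelʳ-≤ (k * 2) k 2 (begin
        k + k * 2                                   ≤⟨ +-mono-≤ k≤degB (k*2≤∑degB+∣Poor∣ z∈A) ⟩
        degB z + (∑ (A - z) degB + ∣ Poor ∣)        ≡⟨ +-assoc (degB z) _ ∣ Poor ∣ ⟨
        degB z + ∑ (A - z) degB + ∣ Poor ∣          ≡⟨ cong (_+ ∣ Poor ∣) (∑-remove degB z∈A) ⟨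
        ∑ A degB + ∣ Poor ∣                         ≡⟨ cong (_+ ∣ Poor ∣) (∑∣N∩Q∣≡∑∣N∩P∣ G A B) ⟩
        ∑ B degA + ∣ Poor ∣                         ≤⟨ +-mono-≤ ∑degA≤k*2+∣Poor∣ ∣Poor∣≤1 ⟩
        k * 2 + ∣ Poor ∣ + 1                        ≤⟨ +-monoˡ-≤ 1 (+-monoʳ-≤ (k * 2) ∣Poor∣≤1) ⟩
        k * 2 + 1 + 1                               ≡⟨ +-assoc (k * 2) 1 1 ⟩
        k * 2 + 2                                   ≡⟨ +-comm (k * 2) 2 ⟩
        2 + k * 2                                   ∎)) (<⇒≱ (m≤k 3 _))
      where
      open ≤-Reasoning
      z∈A : z ∈ A
      z∈A = proj₁ (∈Rich⁻ z∈Rich)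
      k≤degB : k ≤ degB z
      k≤degB = subst (_≤ degB z) ∣B∣≡k (p⊆q⇒∣p∣≤∣q∣ λ b∈B → x∈p∩q⁺ (B⊆Nz b∈B , b∈B))
      ∣Poor∣≤1 : ∣ Poor ∣ ≤ 1
      ∣Poor∣≤1 = ≤-trans (p⊆q⇒∣p∣≤∣q∣ Poor⊆N∩A) ∣N∩A∣≤1
        where
        Poor⊆N∩A : Poor ⊆ N G z ∩ A
        Poor⊆N∩A a∈Poor = x∈p∩q⁺ (∈N-sym G (Poor⇒adjacent-to-A a∈Poor z∈A (Rich≢Poor z∈Rich a∈Poor)) ,
                                  proj₁ (∈Poor⁻ a∈Poor))

    seed : Seed
    seed with 1 ≤? ∣ Rich ∣
    ... | no  ∣Rich∣≢0 = ⊥-elim (no-Rich-impossible ∣Rich∣≢0)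
    ... | yes 1≤∣Rich∣ with 1≤∣p∣⇒Nonempty 1≤∣Rich∣
    ... | z , z∈Rich with 1 ≤? ∣ Far z ∣ | 2 ≤? ∣ N G z ∩ A ∣
    ... | yes 1≤∣Far∣ | _ = seed-from-Far z∈Rich (proj₂ (1≤∣p∣⇒Nonempty 1≤∣Far∣))
    ... | no  ∣Far∣≢0 | yes 2≤∣N∩A∣ = seed-from-A-neighbours z∈Rich (Far-empty⇒B⊆N ∣Far∣≢0) 2≤∣N∩A∣
    ... | no  ∣Far∣≢0 | no  2≰∣N∩A∣ =
      ⊥-elim (A-non-neighbours-impossible z∈Rich (Far-empty⇒B⊆N ∣Far∣≢0) (≤-pred (≰⇒> 2≰∣N∩A∣)))

seed : ∀ q {k} (G : Graph (2 * k + 1)) (A : Subset (2 * k + 1)) (24+q≤k : 24 + q ≤ k)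
       (δ≥ : MinDegreeAtLeast G (k + suc q)) (∣A∣≡ : ∣ A ∣ ≡ suc k)
       (closed : Bootstrap.StepClosed G (4 + q) A) → Setting.Seed G A 24+q≤k δ≥ ∣A∣≡ closed
seed zero G A 24≤k δ≥ ∣A∣≡ closed =
  [ id , (λ (∣Rich∣≤1 , ¬config) → Setting₄.Sparse.seed G A 24≤k δ≥ ∣A∣≡ closed ∣Rich∣≤1 ¬config) ]′
  seed-or-sparse
  where open Setting G A 24≤k δ≥ ∣A∣≡ closed
seed (suc q) G A 24+q≤k δ≥ ∣A∣≡ closed =
  [ id , (λ (∣Rich∣≤1 , _) → seed-from-BHubConfig (BHubConfig-if-r≥5 (s≤s z≤n) ∣Rich∣≤1)) ]′
  seed-or-sparse
  where open Setting G A 24+q≤k δ≥ ∣A∣≡ closed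

proposition4p7 : ∀ (r : ℕ) → 4 ≤ r →
    ∃ λ (n₀ : ℕ) → ∀ (k : ℕ) → n₀ ≤ 2 * k + 1 →
      (G : Graph (2 * k + 1)) →
      MinDegreeAtLeast G (k + (r ∸ 3)) →
      (Σ (Subset (2 * k + 1)) λ A → ∣ A ∣ ≡ suc k × Closed G r A) →
      MEquals G r r
proposition4p7 r@(suc (suc (suc (suc q)))) (s≤s (s≤s (s≤s (s≤s z≤n)))) =
  2 * (24 + q) + 1 , λ k n₀≤n G δ≥ (A , ∣A∣≡ , A-closed) →
    let 24+q≤k : 24 + q ≤ k
        24+q≤k = *-cancelˡ-≤ 2 (+-cancelʳ-≤ 1 (2 * (24 + q)) (2 * k) n₀≤n)
        R , ∣R∣≤r , spans = seed q G A 24+q≤k δ≥ ∣A∣≡ (Bootstrap.Closed⇒StepClosed G r A-closed)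
        r≤n : r ≤ 2 * k + 1
        r≤n = ≤-trans (+-monoˡ-≤ q (m≤m+n 4 20)) (≤-trans 24+q≤k (≤-trans (m≤m+n k (k + 0)) (m≤m+n (2 * k) 1)))
    in  Bootstrap.Spans⇒∣A∣≤r⇒m≡r G r r≤n spans ∣R∣≤r
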